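{- Let $p$ be a prime, $n\in\mathbb{N}$, $m\ge2$, $0\le i\le n$, $t\in\mathbb{N}\cup\{0\}$ and $d\in\mathbb{Z}$. Let $(b_j)_{j=0}^t$ be a decreasing sequence in $\{0,\dots,m-2\}$ and $(c_j)_{j=0}^t$ an increasing sequence in $\{ -\infty,0,\dots,i-1\}$, with $t>0$ if $c_0=-\infty$. Assume: (1) $d^{p^i}\in U_m$; (2) $b_t=0$; (3) $\phi^{(m)}_d(P(i,c_j))\in p^{1+b_{j-1}}R_m$ for all $0<j\le t$ with $c_j\neq-\infty$, and $\phi^{(m)}_d(P(i,c_0))=0$ if $c_0\neq-\infty$. Let $r\in R_mG_i$ and suppose the image $\overline{(\sigma-d)r}\in R_{m-1}G_i$ lies in $\mathrm{ann}_{R_{m-1}G_i}\langle p^{b_0},\{p^{b_j}(\sigma^{p^{c_j}}-1)\}_{j=1}^t\rangle$ if $c_0=-\infty$, respectively in $\mathrm{ann}_{R_{m-1}G_i}\langle\{p^{b_j}(\sigma^{p^{c_j}}-1)\}_{j=0}^t\rangle$ if $c_0\neq-\infty$. Then in $R_mG_i$, $$(\sigma-d)r\in\langle p^{m-1-b_0}P(i,c_1),\dots,p^{m-1-b_{t-1}}P(i,c_t),p^{m-1}(\sigma-d)\rangle\quad\text{if }c_0=-\infty,$$ $$(\sigma-d)r\in\langle P(i,c_0),p^{m-1-b_0}P(i,c_1),\dots,p^{m-1-b_{t-1}}P(i,c_t),p^{m-1}(\sigma-d)\rangle\quad\text{if }c_0\neq-\infty.$$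
   Context: $G$ is cyclic of order $p^n$ with generator $\sigma$; $G_i$ its quotient of order $p^i$. $R_k=\mathbb{Z}/p^k\mathbb{Z}$; $d$ acts via its image in $R_k$; the bar denotes the image under the natural map $R_mG_i\to R_{m-1}G_i$; $\langle\cdot\rangle$ is the ideal generated. $U_m=1+p^m\mathbb{Z}$. $P(i,j)=\sum_{k=0}^{p^{i-j}-1}\sigma^{kp^j}$, with conventions $\sigma^{p^{ -\infty}}=0$, $P(i,-\infty)=1$. When $d^{p^i}\equiv1\pmod{p^m}$, $\phi^{(m)}_d:R_mG_i\to R_m$ is the ring homomorphism sending $\sigma\mapsto d$ (the map induced by $\sigma^t\mapsto d^t$). -}

module Defs where

open import Data.Nat as ℕ using (ℕ; zero; suc)
open import Data.Integer as ℤ using (ℤ; +_; 0ℤ; 1ℤ; _-_; _*_; _+_; -_)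
open import Data.Integer.Divisibility using (_∣_)
open import Data.Fin using (Fin; toℕ)
import Data.Fin as F
open import Data.Bool using (Bool; true; false; if_then_else_; _∨_)
open import Data.Product using (Σ; _×_; _,_)
open import Relation.Nullary using (does)
open import Relation.Binary.PropositionalEquality using (_≡_)
open import Function using (_∘_)

sumF : ∀ {N} → (Fin N → ℤ) → ℤ
sumF {zero}  f = 0ℤ
sumF {suc N} f = f F.zero + sumF (f ∘ F.suc)

_≡ᶻ_[mod_] : ℤ → ℤ → ℕ → Set
x ≡ᶻ y [mod q ] = (+ q) ∣ (x - y)

-- The group ring (ℤ/q)[C_N] of a cyclic group C_N = ⟨σ⟩ of order N.
-- An element Σ_a x_a σ^a is represented by its integer coefficients
-- x : Fin N → ℤ; equality in (ℤ/q)[C_N] is coefficientwise congruence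
-- mod q (see _≈[_]_).  Thus the image of x ∈ R_m G_i in R_{m-1} G_i is
-- the same coefficient function read modulo p^(m-1).

Elem : ℕ → Set
Elem N = Fin N → ℤ

-- s ≡ toℕ k (mod N), valid for s < 2N (which is the case below).
idxEq : ∀ {N} → ℕ → Fin N → Bool
idxEq {N} s k = does (s ℕ.≟ toℕ k) ∨ does (s ℕ.≟ toℕ k ℕ.+ N)

ind : Bool → ℤ
ind true  = 1ℤ
ind false = 0ℤ

_≈[_]_ : ∀ {N} → Elem N → ℕ → Elem N → Set
x ≈[ q ] y = ∀ a → x a ≡ᶻ y a [mod q ]

0ᴱ : ∀ {N} → Elem N
0ᴱ _ = 0ℤ

ι : ∀ {N} → ℤ → Elem N
ι z a = z * ind (idxEq 0 a)

1ᴱ : ∀ {N} → Elem N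
1ᴱ = ι 1ℤ

σ : ∀ {N} → Elem N
σ a = ind (idxEq 1 a)

_+ᴱ_ : ∀ {N} → Elem N → Elem N → Elem N
(x +ᴱ y) a = x a + y a

-ᴱ_ : ∀ {N} → Elem N → Elem N
(-ᴱ x) a = - x a

_-ᴱ_ : ∀ {N} → Elem N → Elem N → Elem N
x -ᴱ y = x +ᴱ (-ᴱ y)

_*ᴱ_ : ∀ {N} → Elem N → Elem N → Elem N
(x *ᴱ y) k = sumF (λ a → sumF (λ b → ind (idxEq (toℕ a ℕ.+ toℕ b) k) * (x a * y b)))

_^ᴱ_ : ∀ {N} → Elem N → ℕ → Elem N
x ^ᴱ zero  = 1ᴱ
x ^ᴱ suc e = x *ᴱ (x ^ᴱ e)

sumE : ∀ {N k} → (Fin k → Elem N) → Elem N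
sumE {k = zero}  g = 0ᴱ
sumE {k = suc k} g = g F.zero +ᴱ sumE (g ∘ F.suc)

sumℕ : ∀ {N} → ℕ → (ℕ → Elem N) → Elem N
sumℕ zero    f = 0ᴱ
sumℕ (suc n) f = sumℕ n f +ᴱ f n

InIdeal : ∀ {N k} → ℕ → (Fin k → Elem N) → Elem N → Set
InIdeal {N} {k} q g x = Σ (Fin k → Elem N) λ coef → x ≈[ q ] sumE (λ j → coef j *ᴱ g j)

InAnn : ∀ {N k} → ℕ → (Fin k → Elem N) → Elem N → Set
InAnn {N} q g x = ∀ y → InIdeal q g y → (x *ᴱ y) ≈[ q ] 0ᴱ

data ℕ∞ : Set where
  -∞  : ℕ∞
  fin : ℕ → ℕ∞

data _<∞_ : ℕ∞ → ℕ∞ → Set where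
  -∞<fin  : ∀ {x} → -∞ <∞ fin x
  fin<fin : ∀ {x y} → x ℕ.< y → fin x <∞ fin y

-- σ^{p^c}, with σ^{p^{-∞}} = 0
σpow : ∀ {N} → ℕ → ℕ∞ → Elem N
σpow p -∞      = 0ᴱ
σpow p (fin c) = σ ^ᴱ (p ℕ.^ c)

P : ∀ {N} → ℕ → ℕ → ℕ∞ → Elem N
P p i -∞      = 1ᴱ
P p i (fin c) = sumℕ (p ℕ.^ (i ℕ.∸ c)) (λ k → σ ^ᴱ (k ℕ.* p ℕ.^ c))

-- φ_d : σ^a ↦ d^a  (as an integer, to be read mod p^m)
φ : ∀ {N} → ℤ → Elem N → ℤ
φ d x = sumF (λ a → x a * (d ℤ.^ toℕ a))

module _ (p m i : ℕ) (d : ℤ) {t : ℕ} (b : Fin (suc t) → ℕ) (c : Fin (suc t) → ℕ∞) where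

  N : ℕ
  N = p ℕ.^ i

  pe : ℕ → Elem N
  pe e = ι (+ (p ℕ.^ e))

  AnnHyp : ℕ∞ → Elem N → Set
  AnnHyp -∞ x = InAnn (p ℕ.^ (m ℕ.∸ 1)) g x
    where
    g : Fin (suc t) → Elem N
    g F.zero    = pe (b F.zero)
    g (F.suc j) = pe (b (F.suc j)) *ᴱ (σpow p (c (F.suc j)) -ᴱ 1ᴱ)
  AnnHyp (fin _) x = InAnn (p ℕ.^ (m ℕ.∸ 1)) g x
    where
    g : Fin (suc t) → Elem N
    g j = pe (b j) *ᴱ (σpow p (c j) -ᴱ 1ᴱ)

  Concl : ℕ∞ → Elem N → Set
  Concl -∞ x = InIdeal (p ℕ.^ m) g x
    where
    g : Fin (suc t) → Elem N
    g F.zero    = pe (m ℕ.∸ 1) *ᴱ (σ -ᴱ ι d)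
    g (F.suc j) = pe (m ℕ.∸ 1 ℕ.∸ b (F.inject₁ j)) *ᴱ P p i (c (F.suc j))
  Concl (fin _) x = InIdeal (p ℕ.^ m) g x
    where
    g : Fin (suc (suc t)) → Elem N
    g F.zero          = P p i (c F.zero)
    g (F.suc F.zero)  = pe (m ℕ.∸ 1) *ᴱ (σ -ᴱ ι d)
    g (F.suc (F.suc j)) = pe (m ℕ.∸ 1 ℕ.∸ b (F.inject₁ j)) *ᴱ P p i (c (F.suc j))

-- Put x = (σ - d) r and let Xⱼ be the p^cⱼ-periodic element agreeing with x on 0 ≤ k < p^cⱼ
-- (Xⱼ = 0 if cⱼ = -∞). Multiplying x by p^bⱼ (σ^(p^cⱼ) - 1) and cancelling p^bⱼ shows
-- x ≡ Xⱼ mod p^(m-1-bⱼ). As b_t = 0, x ≡ X_t mod p^(m-1), and X_t telescopes into X₀ plus the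
-- differences X_(j+1) - Xⱼ. Each difference is p^c_(j+1)-periodic and divisible by p^(m-1-bⱼ),
-- hence a multiple of p^(m-1-bⱼ) P(i, c_(j+1)); likewise X₀ is a multiple of P(i, c₀). What is
-- left is p^(m-1) u. Division by σ - d gives u ≡ v (σ - d) + φ_d(u) mod p^m, and
-- φ_d(p^(m-1) u) ≡ 0 mod p^m because φ_d kills x, P(i, c₀) and, by hypothesis, every
-- p^(m-1-bⱼ) P(i, c_(j+1)). Hence p^(m-1) u ≡ v p^(m-1) (σ - d) mod p^m.

module Submission where

open import Defs
open import Data.Nat as ℕ using (ℕ; suc; _≤_; _<_)
open import Data.Nat.Primality using (Prime; prime⇒nonZero; prime⇒nonTrivial)
open import Data.Integer as ℤ using (ℤ; +_; 1ℤ; 0ℤ; _-_; _*_)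
open import Data.Fin as F using (Fin; fromℕ; inject₁)
open import Data.Product using (Σ)
open import Relation.Binary.PropositionalEquality using (_≡_; _≢_)

open import Data.Nat using (zero; NonZero; _%_; _/_)
import Data.Nat.Properties as ℕP
import Data.Nat.DivMod as ℕD
import Data.Nat.Divisibility as ℕ∣
open import Data.Integer using (_+_; -_)
import Data.Integer.Properties as ℤP
open import Data.Integer.Divisibility.Signed as ℤ∣ using (_∣_)
open import Data.Integer.Tactic.RingSolver using (solve-∀)
open import Data.Fin using (toℕ; fromℕ<)
import Data.Fin.Properties as FP
open import Data.Product using (_,_; proj₁; proj₂; _×_)
open import Data.Sum using (_⊎_; inj₁; inj₂)
open import Data.Empty using (⊥-elim)
open import Data.Vec.Functional using (_∷_)
open import Function using (_∘_; _⇔_; mk⇔; Equivalence)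
open import Relation.Nullary using (Dec; does; yes; no; _×-dec_; _⊎-dec_)
open import Data.Bool using (true; false)
open import Relation.Nullary.Decidable using (dec-false; does-⇔)
open import Relation.Binary using (IsEquivalence; Setoid)
import Relation.Binary.Reasoning.Setoid as SetoidReasoning
open import Relation.Binary.PropositionalEquality
  using (refl; sym; trans; cong; cong₂; subst; subst₂; module ≡-Reasoning)

-- Signed divisibility, wrapped in a record so that x, y and q can be recovered by unification.
infix 4 _≋_[mod_]
record _≋_[mod_] (x y : ℤ) (q : ℕ) : Set where
  constructor mk≋
  field divides-difference : + q ∣ x - y

≋⇒≡ᶻ : ∀ {q x y} → x ≋ y [mod q ] → x ≡ᶻ y [mod q ]
≋⇒≡ᶻ (mk≋ h) = ℤ∣.∣⇒∣ᵤ h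

≡ᶻ⇒≋ : ∀ {q x y} → x ≡ᶻ y [mod q ] → x ≋ y [mod q ]
≡ᶻ⇒≋ h = mk≋ (ℤ∣.∣ᵤ⇒∣ h)

module _ {q : ℕ} where

  ≋-by-difference : ∀ {x y} z → z ≡ x - y → + q ∣ z → x ≋ y [mod q ]
  ≋-by-difference z refl h = mk≋ h

  ≋-refl : ∀ {x} → x ≋ x [mod q ]
  ≋-refl {x} = ≋-by-difference 0ℤ (sym (ℤP.+-inverseʳ x)) (ℤ∣.divides 0ℤ refl)

  ≋-reflexive : ∀ {x y} → x ≡ y → x ≋ y [mod q ]
  ≋-reflexive refl = ≋-refl

  ≋-sym : ∀ {x y} → x ≋ y [mod q ] → y ≋ x [mod q ]
  ≋-sym {x} {y} (mk≋ h) = ≋-by-difference _ (lemma x y) (ℤ∣.∣m⇒∣-m h)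
    where lemma : ∀ x y → - (x - y) ≡ y - x
          lemma = solve-∀

  ≋-trans : ∀ {x y z} → x ≋ y [mod q ] → y ≋ z [mod q ] → x ≋ z [mod q ]
  ≋-trans {x} {y} {z} (mk≋ h) (mk≋ h′) =
    ≋-by-difference _ (lemma x y z) (ℤ∣.∣m∣n⇒∣m+n h h′)
    where lemma : ∀ x y z → (x - y) + (y - z) ≡ x - z
          lemma = solve-∀

  ≋-isEquivalence : IsEquivalence (λ x y → x ≋ y [mod q ])
  ≋-isEquivalence = record { refl = ≋-refl ; sym = ≋-sym ; trans = ≋-trans }

  ≋-setoid : Setoid _ _
  ≋-setoid = record { isEquivalence = ≋-isEquivalence }

  ≋-+ : ∀ {x y x′ y′} → x ≋ y [mod q ] → x′ ≋ y′ [mod q ] → x + x′ ≋ y + y′ [mod q ]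
  ≋-+ {x} {y} {x′} {y′} (mk≋ h) (mk≋ h′) =
    ≋-by-difference _ (lemma x y x′ y′) (ℤ∣.∣m∣n⇒∣m+n h h′)
    where lemma : ∀ x y x′ y′ → (x - y) + (x′ - y′) ≡ (x + x′) - (y + y′)
          lemma = solve-∀

  ≋-neg : ∀ {x y} → x ≋ y [mod q ] → - x ≋ - y [mod q ]
  ≋-neg {x} {y} (mk≋ h) = ≋-by-difference _ (lemma x y) (ℤ∣.∣m⇒∣-m h)
    where lemma : ∀ x y → - (x - y) ≡ - x - - y
          lemma = solve-∀

  ≋-- : ∀ {x y x′ y′} → x ≋ y [mod q ] → x′ ≋ y′ [mod q ] → x - x′ ≋ y - y′ [mod q ]
  ≋-- h h′ = ≋-+ h (≋-neg h′)

  ≋-*ˡ : ∀ z {x y} → x ≋ y [mod q ] → z * x ≋ z * y [mod q ]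
  ≋-*ˡ z {x} {y} (mk≋ h) = ≋-by-difference _ (lemma z x y) (ℤ∣.∣n⇒∣m*n z h)
    where lemma : ∀ z x y → z * (x - y) ≡ z * x - z * y
          lemma = solve-∀

  ≋-*ʳ : ∀ z {x y} → x ≋ y [mod q ] → x * z ≋ y * z [mod q ]
  ≋-*ʳ z {x} {y} h = subst₂ (λ a b → a ≋ b [mod q ]) (ℤP.*-comm z x) (ℤP.*-comm z y) (≋-*ˡ z h)

  ≋-* : ∀ {x y x′ y′} → x ≋ y [mod q ] → x′ ≋ y′ [mod q ] → x * x′ ≋ y * y′ [mod q ]
  ≋-* {y = y} {x′ = x′} h h′ = ≋-trans (≋-*ʳ x′ h) (≋-*ˡ y h′)

  ≋-^ : ∀ {x y} n → x ≋ y [mod q ] → x ℤ.^ n ≋ y ℤ.^ n [mod q ]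
  ≋-^ zero    h = ≋-refl
  ≋-^ (suc n) h = ≋-* h (≋-^ n h)

  *q≋0 : ∀ z → z * + q ≋ 0ℤ [mod q ]
  *q≋0 z = mk≋ (ℤ∣.divides z (ℤP.+-identityʳ _))

  ≋-sumF : ∀ {n} {f g : Fin n → ℤ} → (∀ a → f a ≋ g a [mod q ]) → sumF f ≋ sumF g [mod q ]
  ≋-sumF {zero}  h = ≋-refl
  ≋-sumF {suc n} h = ≋-+ (h F.zero) (≋-sumF (h ∘ F.suc))

  ≋⇒-≋0 : ∀ {x y} → x ≋ y [mod q ] → x - y ≋ 0ℤ [mod q ]
  ≋⇒-≋0 {x} {y} (mk≋ h) = ≋-by-difference (x - y) (sym (ℤP.+-identityʳ (x - y))) h

  -≋0⇒≋ : ∀ {x y} → x - y ≋ 0ℤ [mod q ] → x ≋ y [mod q ]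
  -≋0⇒≋ {x} {y} (mk≋ h) = ≋-by-difference (x - y - 0ℤ) (ℤP.+-identityʳ (x - y)) h

  ≋0⇒multiple : ∀ {x} → x ≋ 0ℤ [mod q ] → Σ ℤ λ w → x ≡ w * + q
  ≋0⇒multiple {x} (mk≋ (ℤ∣.divides w x-0≡wq)) = w , trans (sym (ℤP.+-identityʳ x)) x-0≡wq

≋-cancel-^ : ∀ p β e .{{_ : NonZero p}} y →
             + (p ℕ.^ β) * y ≋ 0ℤ [mod p ℕ.^ (β ℕ.+ e) ] → y ≋ 0ℤ [mod p ℕ.^ e ]
≋-cancel-^ p β e y (mk≋ h) = mk≋ (subst (+ (p ℕ.^ e) ∣_) (sym (ℤP.+-identityʳ y))
  (ℤ∣.*-cancelˡ-∣ (+ (p ℕ.^ β)) {{ℕP.m^n≢0 p β}} (subst₂ _∣_ split (ℤP.+-identityʳ _) h)))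
  where
  split : + (p ℕ.^ (β ℕ.+ e)) ≡ + (p ℕ.^ β) * + (p ℕ.^ e)
  split = trans (cong +_ (ℕP.^-distribˡ-+-* p β e)) (ℤP.pos-* (p ℕ.^ β) (p ℕ.^ e))

sumF-cong : ∀ {n} {f g : Fin n → ℤ} → (∀ a → f a ≡ g a) → sumF f ≡ sumF g
sumF-cong {zero}  h = refl
sumF-cong {suc n} h = cong₂ _+_ (h F.zero) (sumF-cong (h ∘ F.suc))

sumF-0 : ∀ n → sumF {n} (λ _ → 0ℤ) ≡ 0ℤ
sumF-0 zero    = refl
sumF-0 (suc n) = trans (ℤP.+-identityˡ _) (sumF-0 n)

sumF-+ : ∀ {n} (f g : Fin n → ℤ) → sumF (λ a → f a + g a) ≡ sumF f + sumF g
sumF-+ {zero}  f g = refl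
sumF-+ {suc n} f g = trans (cong (λ s → (f F.zero + g F.zero) + s) (sumF-+ (f ∘ F.suc) (g ∘ F.suc)))
                           (lemma (f F.zero) (g F.zero) (sumF (f ∘ F.suc)) (sumF (g ∘ F.suc)))
  where lemma : ∀ a b c d → a + b + (c + d) ≡ a + c + (b + d)
        lemma = solve-∀

sumF-neg : ∀ {n} (f : Fin n → ℤ) → sumF (λ a → - f a) ≡ - sumF f
sumF-neg {zero}  f = refl
sumF-neg {suc n} f = trans (cong (λ s → - f F.zero + s) (sumF-neg (f ∘ F.suc)))
                           (sym (ℤP.neg-distrib-+ (f F.zero) (sumF (f ∘ F.suc))))

sumF-*ˡ : ∀ {n} z (f : Fin n → ℤ) → sumF (λ a → z * f a) ≡ z * sumF f
sumF-*ˡ {zero}  z f = sym (ℤP.*-zeroʳ z)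
sumF-*ˡ {suc n} z f = trans (cong (λ s → z * f F.zero + s) (sumF-*ˡ z (f ∘ F.suc)))
                            (sym (ℤP.*-distribˡ-+ z _ _))

sumF-*ʳ : ∀ {n} z (f : Fin n → ℤ) → sumF (λ a → f a * z) ≡ sumF f * z
sumF-*ʳ z f = trans (sumF-cong (λ a → ℤP.*-comm (f a) z))
                    (trans (sumF-*ˡ z f) (ℤP.*-comm z (sumF f)))

sumF-swap : ∀ {n n′} (f : Fin n → Fin n′ → ℤ) →
            sumF (λ a → sumF (λ b → f a b)) ≡ sumF (λ b → sumF (λ a → f a b))
sumF-swap {zero}  {n′} f = sym (sumF-0 n′)
sumF-swap {suc n} f = trans (cong (λ s → sumF (f F.zero) + s) (sumF-swap (f ∘ F.suc)))
                            (sym (sumF-+ (f F.zero) (λ b → sumF (λ a → f (F.suc a) b))))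

sumF-δ : ∀ {n} (w : Fin n) (f : Fin n → ℤ) → sumF (λ a → ind (does (w F.≟ a)) * f a) ≡ f w
sumF-δ {suc n} F.zero f =
  trans (cong (λ s → 1ℤ * f F.zero + s) (trans (sumF-cong (λ a → ℤP.*-zeroˡ (f (F.suc a)))) (sumF-0 n)))
        (trans (ℤP.+-identityʳ _) (ℤP.*-identityˡ _))
sumF-δ {suc n} (F.suc w) f = trans (ℤP.+-identityˡ _) (sumF-δ w (f ∘ F.suc))

sumF-telescope : ∀ t (f : Fin (suc t) → ℤ) →
                 f (fromℕ t) ≡ f F.zero + sumF (λ (j : Fin t) → f (F.suc j) - f (inject₁ j))
sumF-telescope zero    f = sym (ℤP.+-identityʳ _)
sumF-telescope (suc t) f = trans (sumF-telescope t (f ∘ F.suc)) (lemma (f F.zero) (f (F.suc F.zero)) _)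
  where lemma : ∀ a b s → b + s ≡ a + ((b - a) + s)
        lemma = solve-∀

sumE-apply : ∀ {N n} (g : Fin n → Elem N) a → sumE g a ≡ sumF (λ j → g j a)
sumE-apply {n = zero}  g a = refl
sumE-apply {n = suc n} g a = cong (λ s → g F.zero a + s) (sumE-apply (g ∘ F.suc) a)

sumℕ-vanishes : ∀ {N} L (f : ℕ → Elem N) b → (∀ l → l < L → f l b ≡ 0ℤ) → sumℕ L f b ≡ 0ℤ
sumℕ-vanishes zero    f b h = refl
sumℕ-vanishes (suc L) f b h =
  cong₂ _+_ (sumℕ-vanishes L f b (λ l l<L → h l (ℕP.m<n⇒m<1+n l<L))) (h L ℕP.≤-refl)

sumℕ-δ-multiples : ∀ {N} A .{{_ : NonZero A}} L (f : ℕ → Elem N) b →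
                   (∀ l → l < L → f l b ≡ ind (does (l ℕ.* A ℕ.≟ toℕ b))) → toℕ b < L ℕ.* A →
                   sumℕ L f b ≡ ind (does (A ℕ∣.∣? toℕ b))
sumℕ-δ-multiples A (suc L) f b h b<[1+L]A with toℕ b ℕ.<? L ℕ.* A
... | yes b<LA =
  trans (cong₂ _+_ (sumℕ-δ-multiples A L f b (λ l l<L → h l (ℕP.m<n⇒m<1+n l<L)) b<LA)
                   (trans (h L ℕP.≤-refl)
                          (cong ind (dec-false (L ℕ.* A ℕ.≟ toℕ b) (λ e → ℕP.<-irrefl (sym e) b<LA)))))
        (ℤP.+-identityʳ _)
... | no b≮LA =
  trans (cong₂ _+_ (sumℕ-vanishes L f b λ l l<L →
                      trans (h l (ℕP.m<n⇒m<1+n l<L))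
                            (cong ind (dec-false (l ℕ.* A ℕ.≟ toℕ b)
                                        (λ e → ℕP.<-irrefl e (ℕP.<-≤-trans (ℕP.*-monoˡ-< A l<L) LA≤b)))))
                   (h L ℕP.≤-refl))
        (trans (ℤP.+-identityˡ _) (cong ind (does-⇔ LA≡b⇔A∣b (L ℕ.* A ℕ.≟ toℕ b) (A ℕ∣.∣? toℕ b))))
  where
  LA≤b : L ℕ.* A ≤ toℕ b
  LA≤b = ℕP.≮⇒≥ b≮LA
  r = toℕ b ℕ.∸ L ℕ.* A
  b≡r+LA : toℕ b ≡ r ℕ.+ L ℕ.* A
  b≡r+LA = sym (ℕP.m∸n+n≡m LA≤b)
  b%A≡r : toℕ b % A ≡ r
  b%A≡r = trans (cong (_% A) b≡r+LA) (trans (ℕD.[m+kn]%n≡m%n r L A) (ℕD.m<n⇒m%n≡m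
            (ℕP.+-cancelʳ-< (L ℕ.* A) r A (subst (_< A ℕ.+ L ℕ.* A) b≡r+LA b<[1+L]A))))
  to : L ℕ.* A ≡ toℕ b → toℕ b % A ≡ 0
  to e = trans b%A≡r (ℕP.+-cancelʳ-≡ (L ℕ.* A) r 0 (trans (sym b≡r+LA) (sym e)))
  from : toℕ b % A ≡ 0 → L ℕ.* A ≡ toℕ b
  from e = trans (cong (ℕ._+ L ℕ.* A) (trans (sym e) b%A≡r)) (sym b≡r+LA)
  LA≡b⇔A∣b : L ℕ.* A ≡ toℕ b ⇔ A ℕ∣.∣ toℕ b
  LA≡b⇔A∣b = mk⇔ (ℕ∣.m%n≡0⇒n∣m _ A ∘ to) (from ∘ ℕ∣.n∣m⇒m%n≡0 _ A)

-- The group ring of a cyclic group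

%-absorbˡ : ∀ m n d .{{_ : NonZero d}} → (m % d ℕ.+ n) % d ≡ (m ℕ.+ n) % d
%-absorbˡ m n d = begin
  (m % d ℕ.+ n) % d         ≡⟨ ℕD.%-distribˡ-+ (m % d) n d ⟩
  (m % d % d ℕ.+ n % d) % d ≡⟨ cong (λ r → (r ℕ.+ n % d) % d) (ℕD.m%n%n≡m%n m d) ⟩
  (m % d ℕ.+ n % d) % d     ≡⟨ ℕD.%-distribˡ-+ m n d ⟨
  (m ℕ.+ n) % d             ∎
  where open ≡-Reasoning

module Cyclic (N : ℕ) .{{_ : NonZero N}} where

  mod-≡⇔ : ∀ s k → s ℕD.mod N ≡ k ⇔ s % N ≡ toℕ k
  mod-≡⇔ s k = mk⇔ (λ { refl → sym (FP.toℕ-fromℕ< _) })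
                   (λ e → FP.toℕ-injective (trans (FP.toℕ-fromℕ< _) e))

  toℕ-mod : ∀ (k : Fin N) → toℕ k % N ≡ toℕ k
  toℕ-mod k = ℕD.m<n⇒m%n≡m (FP.toℕ<n k)

  mod-toℕ : ∀ (k : Fin N) → toℕ k ℕD.mod N ≡ k
  mod-toℕ k = Equivalence.from (mod-≡⇔ (toℕ k) k) (toℕ-mod k)

  _⊖_ : Fin N → Fin N → Fin N
  k ⊖ a = (toℕ k ℕ.+ (N ℕ.∸ toℕ a)) ℕD.mod N

  mod-+≡⇔⊖≡ : ∀ a b k → (toℕ a ℕ.+ toℕ b) ℕD.mod N ≡ k ⇔ k ⊖ a ≡ b
  mod-+≡⇔⊖≡ a b k = mk⇔
    (λ e → Equivalence.from (mod-≡⇔ _ b) (to (Equivalence.to (mod-≡⇔ _ k) e)))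
    (λ e → Equivalence.from (mod-≡⇔ _ k) (from (Equivalence.to (mod-≡⇔ _ b) e)))
    where
    open ≡-Reasoning
    a′ = toℕ a
    b′ = toℕ b
    k′ = toℕ k
    a≤N : a′ ≤ N
    a≤N = ℕP.<⇒≤ (FP.toℕ<n a)
    to : (a′ ℕ.+ b′) % N ≡ k′ → (k′ ℕ.+ (N ℕ.∸ a′)) % N ≡ b′
    to e = begin
      (k′ ℕ.+ (N ℕ.∸ a′)) % N              ≡⟨ cong (λ r → (r ℕ.+ (N ℕ.∸ a′)) % N) e ⟨
      ((a′ ℕ.+ b′) % N ℕ.+ (N ℕ.∸ a′)) % N ≡⟨ %-absorbˡ (a′ ℕ.+ b′) (N ℕ.∸ a′) N ⟩
      (a′ ℕ.+ b′ ℕ.+ (N ℕ.∸ a′)) % N       ≡⟨ cong (λ r → (r ℕ.+ (N ℕ.∸ a′)) % N) (ℕP.+-comm a′ b′) ⟩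
      (b′ ℕ.+ a′ ℕ.+ (N ℕ.∸ a′)) % N       ≡⟨ cong (_% N) (ℕP.+-assoc b′ a′ _) ⟩
      (b′ ℕ.+ (a′ ℕ.+ (N ℕ.∸ a′))) % N     ≡⟨ cong (λ r → (b′ ℕ.+ r) % N) (ℕP.m+[n∸m]≡n a≤N) ⟩
      (b′ ℕ.+ N) % N                       ≡⟨ ℕD.[m+n]%n≡m%n b′ N ⟩
      b′ % N                               ≡⟨ toℕ-mod b ⟩
      b′                                   ∎
    from : (k′ ℕ.+ (N ℕ.∸ a′)) % N ≡ b′ → (a′ ℕ.+ b′) % N ≡ k′
    from e = begin
      (a′ ℕ.+ b′) % N                      ≡⟨ cong (λ r → (a′ ℕ.+ r) % N) e ⟨
      (a′ ℕ.+ (k′ ℕ.+ (N ℕ.∸ a′)) % N) % N ≡⟨ cong (_% N) (ℕP.+-comm a′ _) ⟩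
      ((k′ ℕ.+ (N ℕ.∸ a′)) % N ℕ.+ a′) % N ≡⟨ %-absorbˡ (k′ ℕ.+ (N ℕ.∸ a′)) a′ N ⟩
      (k′ ℕ.+ (N ℕ.∸ a′) ℕ.+ a′) % N       ≡⟨ cong (_% N) (ℕP.+-assoc k′ _ a′) ⟩
      (k′ ℕ.+ ((N ℕ.∸ a′) ℕ.+ a′)) % N     ≡⟨ cong (λ r → (k′ ℕ.+ r) % N) (ℕP.m∸n+n≡m a≤N) ⟩
      (k′ ℕ.+ N) % N                       ≡⟨ ℕD.[m+n]%n≡m%n k′ N ⟩
      k′ % N                               ≡⟨ toℕ-mod k ⟩
      k′                                   ∎

  idxEq-mod : ∀ s k → s < N ℕ.+ N → idxEq s k ≡ does (s ℕD.mod N F.≟ k)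
  idxEq-mod s k s<2N =
    does-⇔ (mk⇔ to from) ((s ℕ.≟ toℕ k) ⊎-dec (s ℕ.≟ toℕ k ℕ.+ N)) (s ℕD.mod N F.≟ k)
    where
    to : s ≡ toℕ k ⊎ s ≡ toℕ k ℕ.+ N → s ℕD.mod N ≡ k
    to (inj₁ refl) = mod-toℕ k
    to (inj₂ refl) = Equivalence.from (mod-≡⇔ _ k) (trans (ℕD.[m+n]%n≡m%n (toℕ k) N) (toℕ-mod k))
    from : s ℕD.mod N ≡ k → s ≡ toℕ k ⊎ s ≡ toℕ k ℕ.+ N
    from e with s ℕ.<? N | Equivalence.to (mod-≡⇔ s k) e
    ... | yes s<N | s%N≡k = inj₁ (trans (sym (ℕD.m<n⇒m%n≡m s<N)) s%N≡k)
    ... | no  s≮N | s%N≡k = inj₂ (begin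
      s                 ≡⟨ ℕP.m∸n+n≡m N≤s ⟨
      s ℕ.∸ N ℕ.+ N     ≡⟨ cong (ℕ._+ N) (ℕD.m<n⇒m%n≡m s∸N<N) ⟨
      (s ℕ.∸ N) % N ℕ.+ N ≡⟨ cong (ℕ._+ N) (trans (ℕD.m≤n⇒[n∸m]%m≡n%m N≤s) s%N≡k) ⟩
      toℕ k ℕ.+ N       ∎)
      where
      open ≡-Reasoning
      N≤s : N ≤ s
      N≤s = ℕP.≮⇒≥ s≮N
      s∸N<N : s ℕ.∸ N < N
      s∸N<N = ℕP.+-cancelʳ-< _ _ N (subst (_< N ℕ.+ N) (sym (ℕP.m∸n+n≡m N≤s)) s<2N)

  *ᴱ-convolutionˡ : ∀ (x y : Elem N) k → (x *ᴱ y) k ≡ sumF (λ a → x a * y (k ⊖ a))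
  *ᴱ-convolutionˡ x y k = sumF-cong λ a →
    trans (sumF-cong λ b → cong (λ β → ind β * (x a * y b))
            (trans (idxEq-mod _ k (ℕP.+-mono-< (FP.toℕ<n a) (FP.toℕ<n b)))
                   (does-⇔ (mod-+≡⇔⊖≡ a b k) (_ F.≟ k) (k ⊖ a F.≟ b))))
          (sumF-δ (k ⊖ a) (λ b → x a * y b))

  *ᴱ-convolutionʳ : ∀ (x y : Elem N) k → (x *ᴱ y) k ≡ sumF (λ b → x (k ⊖ b) * y b)
  *ᴱ-convolutionʳ x y k =
    trans (sumF-swap (λ a b → ind (idxEq (toℕ a ℕ.+ toℕ b) k) * (x a * y b))) (sumF-cong λ b →
    trans (sumF-cong λ a → cong (λ β → ind β * (x a * y b))
            (trans (idxEq-mod _ k (ℕP.+-mono-< (FP.toℕ<n a) (FP.toℕ<n b)))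
              (trans (cong (λ s → does (s ℕD.mod N F.≟ k)) (ℕP.+-comm (toℕ a) (toℕ b)))
                     (does-⇔ (mod-+≡⇔⊖≡ b a k) (_ F.≟ k) (k ⊖ b F.≟ a)))))
          (sumF-δ (k ⊖ b) (λ a → x a * y b)))

  mod-cong : ∀ s s′ → s % N ≡ s′ % N → s ℕD.mod N ≡ s′ ℕD.mod N
  mod-cong s s′ e = Equivalence.from (mod-≡⇔ s _) (trans e (sym (FP.toℕ-fromℕ< _)))

  ⊖-0 : ∀ k → k ⊖ (0 ℕD.mod N) ≡ k
  ⊖-0 k = Equivalence.to (mod-+≡⇔⊖≡ (0 ℕD.mod N) k k)
    (Equivalence.from (mod-≡⇔ _ k)
      (trans (cong (λ u → (u ℕ.+ toℕ k) % N) (FP.toℕ-fromℕ< _))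
             (trans (%-absorbˡ 0 (toℕ k) N) (toℕ-mod k))))

  toℕ-⊖-mod : ∀ A k → A < N → A ≤ toℕ k → toℕ (k ⊖ (A ℕD.mod N)) ≡ toℕ k ℕ.∸ A
  toℕ-⊖-mod A k A<N A≤k = begin
    toℕ (k ⊖ (A ℕD.mod N))                   ≡⟨ FP.toℕ-fromℕ< _ ⟩
    (toℕ k ℕ.+ (N ℕ.∸ toℕ (A ℕD.mod N))) % N ≡⟨ cong (λ v → (toℕ k ℕ.+ (N ℕ.∸ v)) % N)
                                                  (trans (FP.toℕ-fromℕ< _) (ℕD.m<n⇒m%n≡m A<N)) ⟩
    (toℕ k ℕ.+ (N ℕ.∸ A)) % N                ≡⟨ cong (_% N) (ℕP.+-∸-assoc (toℕ k) (ℕP.<⇒≤ A<N)) ⟨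
    (toℕ k ℕ.+ N ℕ.∸ A) % N                  ≡⟨ cong (_% N) (ℕP.+-∸-comm N A≤k) ⟩
    (toℕ k ℕ.∸ A ℕ.+ N) % N                  ≡⟨ ℕD.[m+n]%n≡m%n _ N ⟩
    (toℕ k ℕ.∸ A) % N                        ≡⟨ ℕD.m<n⇒m%n≡m (ℕP.≤-<-trans (ℕP.m∸n≤m (toℕ k) A) (FP.toℕ<n k)) ⟩
    toℕ k ℕ.∸ A                              ∎
    where open ≡-Reasoning

  *ᴱ-δˡ : ∀ (x y : Elem N) w z k → (∀ a → x a ≡ z * ind (does (w F.≟ a))) →
          (x *ᴱ y) k ≡ z * y (k ⊖ w)
  *ᴱ-δˡ x y w z k hx = trans (*ᴱ-convolutionˡ x y k)
    (trans (sumF-cong λ a → trans (cong (_* y (k ⊖ a)) (hx a)) (lemma z _ (y (k ⊖ a))))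
           (sumF-δ w (λ a → z * y (k ⊖ a))))
    where lemma : ∀ z i v → z * i * v ≡ i * (z * v)
          lemma = solve-∀

  *ᴱ-δʳ : ∀ (x y : Elem N) w z k → (∀ b → y b ≡ z * ind (does (w F.≟ b))) →
          (x *ᴱ y) k ≡ x (k ⊖ w) * z
  *ᴱ-δʳ x y w z k hy = trans (*ᴱ-convolutionʳ x y k)
    (trans (sumF-cong λ b → trans (cong (x (k ⊖ b) *_) (hy b)) (lemma (x (k ⊖ b)) z _))
           (sumF-δ w (λ b → x (k ⊖ b) * z)))
    where lemma : ∀ v z i → v * (z * i) ≡ i * (v * z)
          lemma = solve-∀

  ι-δ : ∀ z a → ι z a ≡ z * ind (does (0 ℕD.mod N F.≟ a))
  ι-δ z a = cong (λ β → z * ind β) (idxEq-mod 0 a (ℕP.+-mono-< 0<N 0<N))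
    where 0<N = ℕ.>-nonZero⁻¹ N

  ι-*ᴱ : ∀ z (y : Elem N) k → (ι z *ᴱ y) k ≡ z * y k
  ι-*ᴱ z y k = trans (*ᴱ-δˡ (ι z) y (0 ℕD.mod N) z k (ι-δ z)) (cong (λ w → z * y w) (⊖-0 k))

  *ᴱ-ι : ∀ (x : Elem N) z k → (x *ᴱ ι z) k ≡ x k * z
  *ᴱ-ι x z k = trans (*ᴱ-δʳ x (ι z) (0 ℕD.mod N) z k (ι-δ z)) (cong (λ w → x w * z) (⊖-0 k))

  σ-δ : ∀ b → σ b ≡ ind (does (1 ℕD.mod N F.≟ b))
  σ-δ b = cong ind (idxEq-mod 1 b (ℕP.+-mono-≤ (ℕ.>-nonZero⁻¹ N) (ℕ.>-nonZero⁻¹ N)))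

  σ^-δ : ∀ e a → (σ ^ᴱ e) a ≡ ind (does (e ℕD.mod N F.≟ a))
  σ^-δ zero    a = trans (ι-δ 1ℤ a) (ℤP.*-identityˡ _)
  σ^-δ (suc e) a =
    trans (*ᴱ-δˡ σ (σ ^ᴱ e) w 1ℤ a (λ b → trans (σ-δ b) (sym (ℤP.*-identityˡ _))))
          (trans (ℤP.*-identityˡ _)
                 (trans (σ^-δ e (a ⊖ w))
                        (cong ind (does-⇔ shift (e ℕD.mod N F.≟ a ⊖ w) (suc e ℕD.mod N F.≟ a)))))
    where
    w = 1 ℕD.mod N
    sum≡ : (toℕ w ℕ.+ toℕ (e ℕD.mod N)) ℕD.mod N ≡ suc e ℕD.mod N
    sum≡ = mod-cong _ (suc e)
             (trans (cong₂ (λ u v → (u ℕ.+ v) % N) (FP.toℕ-fromℕ< (ℕD.m%n<n 1 N)) (FP.toℕ-fromℕ< (ℕD.m%n<n e N)))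
                    (sym (ℕD.%-distribˡ-+ 1 e N)))
    shift : e ℕD.mod N ≡ a ⊖ w ⇔ suc e ℕD.mod N ≡ a
    shift = mk⇔ (λ h → trans (sym sum≡) (Equivalence.from (mod-+≡⇔⊖≡ w _ a) (sym h)))
                (λ h → sym (Equivalence.to (mod-+≡⇔⊖≡ w _ a) (trans sum≡ h)))

  *ᴱ-linearʳ : ∀ (x y y₁ y₂ : Elem N) α β k → (∀ b → y b ≡ α * y₁ b + β * y₂ b) →
               (x *ᴱ y) k ≡ α * (x *ᴱ y₁) k + β * (x *ᴱ y₂) k
  *ᴱ-linearʳ x y y₁ y₂ α β k h = begin
    (x *ᴱ y) k
      ≡⟨ *ᴱ-convolutionʳ x y k ⟩
    sumF (λ b → x (k ⊖ b) * y b)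
      ≡⟨ sumF-cong (λ b → trans (cong (x (k ⊖ b) *_) (h b)) (lemma (x (k ⊖ b)) α β (y₁ b) (y₂ b))) ⟩
    sumF (λ b → α * (x (k ⊖ b) * y₁ b) + β * (x (k ⊖ b) * y₂ b))
      ≡⟨ sumF-+ (λ b → α * (x (k ⊖ b) * y₁ b)) (λ b → β * (x (k ⊖ b) * y₂ b)) ⟩
    sumF (λ b → α * (x (k ⊖ b) * y₁ b)) + sumF (λ b → β * (x (k ⊖ b) * y₂ b))
      ≡⟨ cong₂ _+_ (sumF-*ˡ α (λ b → x (k ⊖ b) * y₁ b)) (sumF-*ˡ β (λ b → x (k ⊖ b) * y₂ b)) ⟩
    α * sumF (λ b → x (k ⊖ b) * y₁ b) + β * sumF (λ b → x (k ⊖ b) * y₂ b)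
      ≡⟨ cong₂ (λ u v → α * u + β * v) (*ᴱ-convolutionʳ x y₁ k) (*ᴱ-convolutionʳ x y₂ k) ⟨
    α * (x *ᴱ y₁) k + β * (x *ᴱ y₂) k ∎
    where
    open ≡-Reasoning
    lemma : ∀ x α β a b → x * (α * a + β * b) ≡ α * (x * a) + β * (x * b)
    lemma = solve-∀

  *ᴱ-ι-*ᴱ : ∀ (x y : Elem N) z k → (x *ᴱ (ι z *ᴱ y)) k ≡ z * (x *ᴱ y) k
  *ᴱ-ι-*ᴱ x y z k =
    trans (*ᴱ-linearʳ x (ι z *ᴱ y) y y z 0ℤ k (λ b → trans (ι-*ᴱ z y b) (sym (ℤP.+-identityʳ _))))
          (ℤP.+-identityʳ _)

  *ᴱ-[σ^-1] : ∀ (x : Elem N) z A k →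
              (x *ᴱ (ι z *ᴱ ((σ ^ᴱ A) -ᴱ 1ᴱ))) k ≡ z * (x (k ⊖ (A ℕD.mod N)) - x k)
  *ᴱ-[σ^-1] x z A k =
    trans (*ᴱ-linearʳ x _ (σ ^ᴱ A) 1ᴱ z (- z) k
             (λ b → trans (ι-*ᴱ z ((σ ^ᴱ A) -ᴱ 1ᴱ) b) (lemma₁ z ((σ ^ᴱ A) b) (1ᴱ b))))
          (trans (cong₂ (λ u v → z * u + - z * v)
                   (trans (*ᴱ-δʳ x (σ ^ᴱ A) (A ℕD.mod N) 1ℤ k
                             (λ b → trans (σ^-δ A b) (sym (ℤP.*-identityˡ _))))
                          (ℤP.*-identityʳ _))
                   (trans (*ᴱ-ι x 1ℤ k) (ℤP.*-identityʳ _)))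
                 (lemma₂ z (x (k ⊖ (A ℕD.mod N))) (x k)))
    where
    lemma₁ : ∀ z a b → z * (a + - b) ≡ z * a + - z * b
    lemma₁ = solve-∀
    lemma₂ : ∀ z a b → z * a + - z * b ≡ z * (a - b)
    lemma₂ = solve-∀

-- The evaluation φ_d : σ ↦ d

module Evaluation (N : ℕ) .{{_ : NonZero N}} (d : ℤ) where
  open Cyclic N

  φ-cong : ∀ {x y : Elem N} → (∀ a → x a ≡ y a) → φ d x ≡ φ d y
  φ-cong h = sumF-cong (λ a → cong (_* d ℤ.^ toℕ a) (h a))

  φ-+ : ∀ (x y : Elem N) → φ d (x +ᴱ y) ≡ φ d x + φ d y
  φ-+ x y = trans (sumF-cong (λ a → ℤP.*-distribʳ-+ (d ℤ.^ toℕ a) (x a) (y a)))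
                  (sumF-+ (λ a → x a * d ℤ.^ toℕ a) (λ a → y a * d ℤ.^ toℕ a))

  φ-neg : ∀ (x : Elem N) → φ d (-ᴱ x) ≡ - φ d x
  φ-neg x = trans (sumF-cong (λ a → sym (ℤP.neg-distribˡ-* (x a) (d ℤ.^ toℕ a))))
                  (sumF-neg (λ a → x a * d ℤ.^ toℕ a))

  φ-0 : φ d (0ᴱ {N}) ≡ 0ℤ
  φ-0 = trans (sumF-cong {N} (λ a → ℤP.*-zeroˡ (d ℤ.^ toℕ a))) (sumF-0 N)

  φ-*ʳ : ∀ (x : Elem N) z → φ d (λ k → x k * z) ≡ φ d x * z
  φ-*ʳ x z = trans (sumF-cong (λ k → lemma (x k) z (d ℤ.^ toℕ k)))
                   (sumF-*ʳ z (λ k → x k * d ℤ.^ toℕ k))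
    where lemma : ∀ a z b → a * z * b ≡ a * b * z
          lemma = solve-∀

  φ-sumF : ∀ {n} (f : Fin n → Elem N) → φ d (λ k → sumF (λ j → f j k)) ≡ sumF (λ j → φ d (f j))
  φ-sumF f = trans (sumF-cong (λ k → sym (sumF-*ʳ (d ℤ.^ toℕ k) (λ j → f j k))))
                   (sumF-swap (λ k j → f j k * d ℤ.^ toℕ k))

  φ-δ : ∀ s z → s < N → φ {N} d (λ a → z * ind (does (s ℕD.mod N F.≟ a))) ≡ z * d ℤ.^ s
  φ-δ s z s<N = begin
    φ d (λ a → z * ind (does (s ℕD.mod N F.≟ a)))
      ≡⟨ sumF-cong (λ a → lemma z (ind (does (s ℕD.mod N F.≟ a))) (d ℤ.^ toℕ a)) ⟩
    sumF (λ a → ind (does (s ℕD.mod N F.≟ a)) * (z * d ℤ.^ toℕ a))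
      ≡⟨ sumF-δ (s ℕD.mod N) (λ a → z * d ℤ.^ toℕ a) ⟩
    z * d ℤ.^ toℕ (s ℕD.mod N)
      ≡⟨ cong (λ e → z * d ℤ.^ e) (trans (FP.toℕ-fromℕ< _) (ℕD.m<n⇒m%n≡m s<N)) ⟩
    z * d ℤ.^ s ∎
    where
    open ≡-Reasoning
    lemma : ∀ z i v → z * i * v ≡ i * (z * v)
    lemma = solve-∀

  φ-ι : ∀ z → φ d (ι {N} z) ≡ z
  φ-ι z = trans (φ-cong (ι-δ z)) (trans (φ-δ 0 z (ℕ.>-nonZero⁻¹ N)) (ℤP.*-identityʳ z))

  φ-σ-ι : 1 < N → φ d (σ {N} -ᴱ ι d) ≡ 0ℤ
  φ-σ-ι 1<N = trans (φ-+ σ (-ᴱ ι d)) (trans (cong₂ _+_ φ-σ (trans (φ-neg (ι d)) (cong -_ (φ-ι d))))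
                                            (ℤP.+-inverseʳ d))
    where
    φ-σ : φ d (σ {N}) ≡ d
    φ-σ = trans (φ-cong (λ a → trans (σ-δ a) (sym (ℤP.*-identityˡ _))))
                (trans (φ-δ 1 1ℤ 1<N) (trans (ℤP.*-identityˡ _) (ℤP.*-identityʳ d)))

  module _ {M : ℕ} (dᴺ≋1 : d ℤ.^ N ≋ 1ℤ [mod M ]) where

    ^-mod : ∀ s → d ℤ.^ (s % N) ≋ d ℤ.^ s [mod M ]
    ^-mod s = ≋-sym (begin
      d ℤ.^ s                              ≡⟨ split ⟩
      d ℤ.^ (s % N) * (d ℤ.^ N) ℤ.^ (s / N) ≈⟨ ≋-*ˡ (d ℤ.^ (s % N)) (≋-^ (s / N) dᴺ≋1) ⟩
      d ℤ.^ (s % N) * 1ℤ ℤ.^ (s / N)        ≡⟨ cong (d ℤ.^ (s % N) *_) (ℤP.^-zeroˡ (s / N)) ⟩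
      d ℤ.^ (s % N) * 1ℤ                   ≡⟨ ℤP.*-identityʳ _ ⟩
      d ℤ.^ (s % N)                        ∎)
      where
      open SetoidReasoning ≋-setoid
      split : d ℤ.^ s ≡ d ℤ.^ (s % N) * (d ℤ.^ N) ℤ.^ (s / N)
      split = trans (cong (d ℤ.^_) (trans (ℕD.m≡m%n+[m/n]*n s N) (cong (s % N ℕ.+_) (ℕP.*-comm (s / N) N))))
                    (trans (ℤP.^-distribˡ-+-* d (s % N) (N ℕ.* (s / N)))
                           (cong (d ℤ.^ (s % N) *_) (sym (ℤP.^-*-assoc d N (s / N)))))

    φ-*ᴱ : ∀ (x y : Elem N) → φ d (x *ᴱ y) ≋ φ d x * φ d y [mod M ]
    φ-*ᴱ x y = begin
      φ d (x *ᴱ y)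
        ≡⟨ sumF-cong (λ k → trans (sym (sumF-*ʳ (D k) (λ a → sumF (λ b → I a b k * (x a * y b)))))
             (sumF-cong λ a → trans (sym (sumF-*ʳ (D k) (λ b → I a b k * (x a * y b))))
               (sumF-cong λ b → ℤP.*-assoc (I a b k) (x a * y b) (D k)))) ⟩
      sumF (λ k → sumF (λ a → sumF (λ b → I a b k * (x a * y b * D k))))
        ≡⟨ trans (sumF-swap (λ k a → sumF (λ b → I a b k * (x a * y b * D k))))
                 (sumF-cong λ a → sumF-swap (λ k b → I a b k * (x a * y b * D k))) ⟩
      sumF (λ a → sumF (λ b → sumF (λ k → I a b k * (x a * y b * D k))))
        ≡⟨ sumF-cong (λ a → sumF-cong λ b →
             trans (sumF-cong (λ k → cong (λ β → ind β * (x a * y b * D k))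
                                          (idxEq-mod _ k (ℕP.+-mono-< (FP.toℕ<n a) (FP.toℕ<n b)))))
                   (sumF-δ ((toℕ a ℕ.+ toℕ b) ℕD.mod N) (λ k → x a * y b * D k))) ⟩
      sumF (λ a → sumF (λ b → x a * y b * D ((toℕ a ℕ.+ toℕ b) ℕD.mod N)))
        ≈⟨ ≋-sumF (λ a → ≋-sumF λ b → ≋-*ˡ (x a * y b)
             (≋-trans (≋-reflexive (cong (d ℤ.^_) (FP.toℕ-fromℕ< (ℕD.m%n<n (toℕ a ℕ.+ toℕ b) N))))
                      (^-mod (toℕ a ℕ.+ toℕ b)))) ⟩
      sumF (λ a → sumF (λ b → x a * y b * d ℤ.^ (toℕ a ℕ.+ toℕ b)))
        ≡⟨ sumF-cong (λ a → sumF-cong λ b →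
             trans (cong (x a * y b *_) (ℤP.^-distribˡ-+-* d (toℕ a) (toℕ b)))
                   (lemma (x a) (y b) (D a) (D b))) ⟩
      sumF (λ a → sumF (λ b → (x a * D a) * (y b * D b)))
        ≡⟨ sumF-cong (λ a → sumF-*ˡ (x a * D a) (λ b → y b * D b)) ⟩
      sumF (λ a → (x a * D a) * φ d y)
        ≡⟨ sumF-*ʳ (φ d y) (λ a → x a * D a) ⟩
      φ d x * φ d y ∎
      where
      open SetoidReasoning ≋-setoid
      D : Fin N → ℤ
      D k = d ℤ.^ toℕ k
      I : Fin N → Fin N → Fin N → ℤ
      I a b k = ind (idxEq (toℕ a ℕ.+ toℕ b) k)
      lemma : ∀ x y u v → x * y * (u * v) ≡ (x * u) * (y * v)
      lemma = solve-∀

module _ {N : ℕ} .{{_ : NonZero N}} where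
  open Cyclic N

  combination⇒InIdeal : ∀ {n q} (coefficients g : Fin n → Elem N) x →
                        (∀ k → x k ≋ sumF (λ l → (coefficients l *ᴱ g l) k) [mod q ]) → InIdeal q g x
  combination⇒InIdeal coefficients g x h = coefficients , λ k →
    ≋⇒≡ᶻ (≋-trans (h k) (≋-reflexive (sym (sumE-apply (λ l → coefficients l *ᴱ g l) k))))

  generator∈ideal : ∀ {n} q (g : Fin n → Elem N) j → InIdeal q g (g j)
  generator∈ideal q g j = combination⇒InIdeal coefficient g (g j) λ a → ≋-reflexive (sym (begin
    sumF (λ l → (coefficient l *ᴱ g l) a)      ≡⟨ sumF-cong (λ l → ι-*ᴱ (ind (does (j F.≟ l))) (g l) a) ⟩
    sumF (λ l → ind (does (j F.≟ l)) * g l a)  ≡⟨ sumF-δ j (λ l → g l a) ⟩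
    g j a                                      ∎))
    where
    open ≡-Reasoning
    coefficient : Fin _ → Elem N
    coefficient l = ι (ind (does (j F.≟ l)))

  annihilator-kills-generator : ∀ {n} q (g : Fin n → Elem N) x → InAnn q g x →
                                ∀ j k → (x *ᴱ g j) k ≋ 0ℤ [mod q ]
  annihilator-kills-generator q g x x∈ann j k = ≡ᶻ⇒≋ (x∈ann (g j) (generator∈ideal q g j) k)

-- Periodic elements and P(i, c)

^-monoʳ-∣ : ∀ p {a b} → a ≤ b → p ℕ.^ a ℕ∣.∣ p ℕ.^ b
^-monoʳ-∣ p {a} {b} a≤b = ℕ∣.divides (p ℕ.^ (b ℕ.∸ a))
  (trans (cong (p ℕ.^_) (sym (ℕP.m∸n+n≡m a≤b))) (ℕP.^-distribˡ-+-* p (b ℕ.∸ a) a))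

fold : ∀ {N} A .{{_ : NonZero A}} → Fin N → Fin N
fold A k = fromℕ< (ℕP.≤-<-trans (ℕD.m%n≤m (toℕ k) A) (FP.toℕ<n k))

toℕ-fold : ∀ {N} A .{{_ : NonZero A}} (k : Fin N) → toℕ (fold A k) ≡ toℕ k % A
toℕ-fold A k = FP.toℕ-fromℕ< _

fold-fold : ∀ {N} A A′ .{{_ : NonZero A}} .{{_ : NonZero A′}} → A ℕ∣.∣ A′ →
            (k : Fin N) → fold A (fold A′ k) ≡ fold A k
fold-fold A A′ A∣A′ k = FP.toℕ-injective (begin
  toℕ (fold A (fold A′ k)) ≡⟨ toℕ-fold A (fold A′ k) ⟩
  toℕ (fold A′ k) % A      ≡⟨ cong (_% A) (toℕ-fold A′ k) ⟩
  toℕ k % A′ % A           ≡⟨ ℕD.m∣n⇒o%n%m≡o%m A A′ (toℕ k) A∣A′ ⟩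
  toℕ k % A                ≡⟨ toℕ-fold A k ⟨
  toℕ (fold A k)           ∎)
  where open ≡-Reasoning

fold-< : ∀ {N} A .{{_ : NonZero A}} (k : Fin N) → toℕ k < A → fold A k ≡ k
fold-< A k k<A = FP.toℕ-injective (trans (toℕ-fold A k) (ℕD.m<n⇒m%n≡m k<A))

truncate : ∀ {N} → ℕ → Elem N → Elem N
truncate A W a = ind (does (toℕ a ℕ.<? A)) * W a

ind-× : ∀ {A B : Set} (a? : Dec A) (b? : Dec B) → ind (does a?) * ind (does b?) ≡ ind (does (a? ×-dec b?))
ind-× a? b? with does a? | does b?
... | false | _     = refl
... | true  | false = refl
... | true  | true  = refl

module Periodic (N : ℕ) .{{_ : NonZero N}} where
  open Cyclic N

  shift-invariant⇒periodic : ∀ A .{{_ : NonZero A}} → A < N → ∀ {Q} (x : Elem N) →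
                             (∀ k → x (k ⊖ (A ℕD.mod N)) ≋ x k [mod Q ]) →
                             ∀ k → x k ≋ x (fold A k) [mod Q ]
  shift-invariant⇒periodic A A<N {Q} x invariant k = bounded N k (FP.toℕ<n k)
    where
    bounded : ∀ n k → toℕ k < n → x k ≋ x (fold A k) [mod Q ]
    bounded (suc n) k k<1+n with toℕ k ℕ.<? A
    ... | yes k<A = ≋-reflexive (cong x (sym (fold-< A k k<A)))
    ... | no  k≮A = ≋-trans (≋-sym (invariant k))
                            (subst (λ j → x k′ ≋ x j [mod Q ]) same-fold (bounded n k′ k′<n))
      where
      k′ = k ⊖ (A ℕD.mod N)
      A≤k : A ≤ toℕ k
      A≤k = ℕP.≮⇒≥ k≮A
      toℕk′ : toℕ k′ ≡ toℕ k ℕ.∸ A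
      toℕk′ = toℕ-⊖-mod A k A<N A≤k
      k′<n : toℕ k′ < n
      k′<n = subst (_< n) (sym toℕk′)
               (ℕP.<-≤-trans (ℕP.∸-monoʳ-< {toℕ k} {A} {0} (ℕ.>-nonZero⁻¹ A) A≤k) (ℕ.s≤s⁻¹ k<1+n))
      same-fold : fold A k′ ≡ fold A k
      same-fold = FP.toℕ-injective (trans (toℕ-fold A k′) (trans (cong (_% A) toℕk′)
                    (trans (ℕD.m≤n⇒[n∸m]%m≡n%m A≤k) (sym (toℕ-fold A k)))))

  truncate-*ᴱ : ∀ A .{{_ : NonZero A}} → A ℕ∣.∣ N → ∀ (W y : Elem N) z k →
                (∀ b → y b ≡ z * ind (does (A ℕ∣.∣? toℕ b))) →
                (truncate A W *ᴱ y) k ≡ z * W (fold A k)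
  truncate-*ᴱ A A∣N W y z k hy = begin
    (truncate A W *ᴱ y) k
      ≡⟨ *ᴱ-convolutionˡ (truncate A W) y k ⟩
    sumF (λ a → ind (does (toℕ a ℕ.<? A)) * W a * y (k ⊖ a))
      ≡⟨ sumF-cong (λ a → trans (cong (ind (does (toℕ a ℕ.<? A)) * W a *_) (hy (k ⊖ a)))
                                (lemma (ind (does (toℕ a ℕ.<? A))) (W a) z _)) ⟩
    sumF (λ a → ind (does (toℕ a ℕ.<? A)) * ind (does (A ℕ∣.∣? toℕ (k ⊖ a))) * (z * W a))
      ≡⟨ sumF-cong (λ a → cong (_* (z * W a))
           (trans (ind-× (toℕ a ℕ.<? A) (A ℕ∣.∣? toℕ (k ⊖ a)))
                  (cong ind (does-⇔ (residue a) (toℕ a ℕ.<? A ×-dec A ℕ∣.∣? toℕ (k ⊖ a)) (fold A k F.≟ a))))) ⟩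
    sumF (λ a → ind (does (fold A k F.≟ a)) * (z * W a))
      ≡⟨ sumF-δ (fold A k) (λ a → z * W a) ⟩
    z * W (fold A k) ∎
    where
    open ≡-Reasoning
    lemma : ∀ i w z j → i * w * (z * j) ≡ i * j * (z * w)
    lemma = solve-∀
    residue : ∀ a → (toℕ a < A × A ℕ∣.∣ toℕ (k ⊖ a)) ⇔ fold A k ≡ a
    residue a = mk⇔ (λ (a<A , A∣) → to (a<A , ℕ∣.n∣m⇒m%n≡0 _ A A∣))
                    (λ e → let (a<A , r≡0) = from e in a<A , ℕ∣.m%n≡0⇒n∣m _ A r≡0)
      where
      a≤N = ℕP.<⇒≤ (FP.toℕ<n a)
      X = toℕ k ℕ.+ (N ℕ.∸ toℕ a)
      [k⊖a]%A : toℕ (k ⊖ a) % A ≡ X % A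
      [k⊖a]%A = trans (cong (_% A) (FP.toℕ-fromℕ< _)) (ℕD.m∣n⇒o%n%m≡o%m A N X A∣N)
      to : toℕ a < A × toℕ (k ⊖ a) % A ≡ 0 → fold A k ≡ a
      to (a<A , e) = FP.toℕ-injective (begin
        toℕ (fold A k)            ≡⟨ toℕ-fold A k ⟩
        toℕ k % A                 ≡⟨ ℕD.%-remove-+ʳ (toℕ k) A∣N ⟨
        (toℕ k ℕ.+ N) % A         ≡⟨ cong (λ v → (toℕ k ℕ.+ v) % A) (ℕP.m∸n+n≡m a≤N) ⟨
        (toℕ k ℕ.+ (N ℕ.∸ toℕ a ℕ.+ toℕ a)) % A ≡⟨ cong (_% A) (ℕP.+-assoc (toℕ k) _ (toℕ a)) ⟨
        (X ℕ.+ toℕ a) % A         ≡⟨ %-absorbˡ X (toℕ a) A ⟨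
        (X % A ℕ.+ toℕ a) % A     ≡⟨ cong (λ v → (v ℕ.+ toℕ a) % A) (trans (sym [k⊖a]%A) e) ⟩
        toℕ a % A                 ≡⟨ ℕD.m<n⇒m%n≡m a<A ⟩
        toℕ a                     ∎)
      from : fold A k ≡ a → toℕ a < A × toℕ (k ⊖ a) % A ≡ 0
      from refl = subst (_< A) (sym (toℕ-fold A k)) (ℕD.m%n<n (toℕ k) A) , (begin
        toℕ (k ⊖ fold A k) % A          ≡⟨ [k⊖a]%A ⟩
        X % A                           ≡⟨ %-absorbˡ (toℕ k) (N ℕ.∸ toℕ a) A ⟨
        (toℕ k % A ℕ.+ (N ℕ.∸ toℕ a)) % A ≡⟨ cong (λ v → (v ℕ.+ (N ℕ.∸ toℕ a)) % A) (toℕ-fold A k) ⟨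
        (toℕ a ℕ.+ (N ℕ.∸ toℕ a)) % A   ≡⟨ cong (_% A) (ℕP.m+[n∸m]≡n a≤N) ⟩
        N % A                           ≡⟨ ℕ∣.n∣m⇒m%n≡0 N A A∣N ⟩
        0                               ∎)

P-indicator : ∀ p .{{_ : NonZero p}} i c → c ≤ i → (b : Fin (p ℕ.^ i)) →
      P {p ℕ.^ i} p i (fin c) b ≡ ind (does (p ℕ.^ c ℕ∣.∣? toℕ b))
P-indicator p i c c≤i b = sumℕ-δ-multiples A L (λ l → σ ^ᴱ (l ℕ.* A)) b multiple (subst (toℕ b <_) (sym LA≡N) (FP.toℕ<n b))
  where
  instance
    _ = ℕP.m^n≢0 p i
    _ = ℕP.m^n≢0 p c
  open Cyclic (p ℕ.^ i)
  A = p ℕ.^ c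
  L = p ℕ.^ (i ℕ.∸ c)
  LA≡N : L ℕ.* A ≡ p ℕ.^ i
  LA≡N = trans (sym (ℕP.^-distribˡ-+-* p (i ℕ.∸ c) c)) (cong (p ℕ.^_) (ℕP.m∸n+n≡m c≤i))
  multiple : ∀ l → l < L → (σ ^ᴱ (l ℕ.* A)) b ≡ ind (does (l ℕ.* A ℕ.≟ toℕ b))
  multiple l l<L = trans (σ^-δ (l ℕ.* A) b) (cong ind (does-⇔ small (_ F.≟ b) (_ ℕ.≟ toℕ b)))
    where
    lA%N : (l ℕ.* A) % p ℕ.^ i ≡ l ℕ.* A
    lA%N = ℕD.m<n⇒m%n≡m (subst (l ℕ.* A <_) LA≡N (ℕP.*-monoˡ-< A l<L))
    small : (l ℕ.* A) ℕD.mod p ℕ.^ i ≡ b ⇔ l ℕ.* A ≡ toℕ b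
    small = mk⇔ (λ e → trans (sym lA%N) (Equivalence.to (mod-≡⇔ _ b) e))
                (λ e → Equivalence.from (mod-≡⇔ _ b) (trans lA%N e))

-- Division by σ - d

module Division (N : ℕ) .{{_ : NonZero N}} (1<N : 1 < N) (d : ℤ) where
  open Cyclic N
  open Evaluation N d

  private
    extend : Elem N → ℕ → ℤ
    extend u n with n ℕ.<? N
    ... | yes n<N = u (fromℕ< n<N)
    ... | no  _   = 0ℤ

    extend-toℕ : ∀ u (k : Fin N) → extend u (toℕ k) ≡ u k
    extend-toℕ u k with toℕ k ℕ.<? N
    ... | yes k<N = cong u (FP.fromℕ<-toℕ k k<N)
    ... | no  k≮N = ⊥-elim (k≮N (FP.toℕ<n k))

    -- the value of the quotient at N - 1 - s
    from-top : Elem N → ℕ → ℤ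
    from-top u zero    = 0ℤ
    from-top u (suc s) = extend u (N ℕ.∸ 1 ℕ.∸ s) + d * from-top u s

  -- v k = Σ_{k < j < N} d^(j-k-1) u j, built by the recursion v (k - 1) = u k + d v k.
  σ-d-quotient : Elem N → Elem N
  σ-d-quotient u a = from-top u (N ℕ.∸ 1 ℕ.∸ toℕ a)

  σ-d-quotient-step : ∀ u k → toℕ k ≢ 0 → (σ-d-quotient u *ᴱ (σ -ᴱ ι d)) k ≡ u k
  σ-d-quotient-step u k k≢0 = begin
    (v *ᴱ (σ -ᴱ ι d)) k
      ≡⟨ *ᴱ-linearʳ v (σ -ᴱ ι d) σ (ι 1ℤ) 1ℤ (- d) k (λ b → lemma₁ (σ b) d (ind (idxEq 0 b))) ⟩
    1ℤ * (v *ᴱ σ) k + - d * (v *ᴱ ι 1ℤ) k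
      ≡⟨ cong₂ (λ a b → 1ℤ * a + - d * b)
           (*ᴱ-δʳ v σ (1 ℕD.mod N) 1ℤ k (λ b → trans (σ-δ b) (sym (ℤP.*-identityˡ _))))
           (*ᴱ-ι v 1ℤ k) ⟩
    1ℤ * (v (k ⊖ (1 ℕD.mod N)) * 1ℤ) + - d * (v k * 1ℤ)
      ≡⟨ cong (λ a → 1ℤ * (a * 1ℤ) + - d * (v k * 1ℤ)) previous ⟩
    1ℤ * ((u k + d * v k) * 1ℤ) + - d * (v k * 1ℤ)
      ≡⟨ lemma₂ (u k) d (v k) ⟩
    u k ∎
    where
    open ≡-Reasoning
    v = σ-d-quotient u
    lemma₁ : ∀ s d i → s + - (d * i) ≡ 1ℤ * s + - d * (1ℤ * i)
    lemma₁ = solve-∀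
    lemma₂ : ∀ u d v → 1ℤ * ((u + d * v) * 1ℤ) + - d * (v * 1ℤ) ≡ u
    lemma₂ = solve-∀
    ∸-suc : ∀ m n → n < m → m ℕ.∸ n ≡ suc (m ℕ.∸ suc n)
    ∸-suc (suc m) zero    _         = refl
    ∸-suc (suc m) (suc n) (ℕ.s≤s h) = ∸-suc m n h
    1≤k : 1 ≤ toℕ k
    1≤k = ℕP.n≢0⇒n>0 k≢0
    k≤N∸1 : toℕ k ≤ N ℕ.∸ 1
    k≤N∸1 = ℕP.m+n≤o⇒m≤o∸n (toℕ k) (subst (_≤ N) (ℕP.+-comm 1 (toℕ k)) (FP.toℕ<n k))
    suc[k∸1] : suc (toℕ k ℕ.∸ 1) ≡ toℕ k
    suc[k∸1] = trans (cong suc (sym (ℕP.pred[m∸n]≡m∸[1+n] (toℕ k) 0))) (ℕP.suc-pred (toℕ k) {{ℕ.≢-nonZero k≢0}})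
    index : N ℕ.∸ 1 ℕ.∸ toℕ (k ⊖ (1 ℕD.mod N)) ≡ suc (N ℕ.∸ 1 ℕ.∸ toℕ k)
    index = begin
      N ℕ.∸ 1 ℕ.∸ toℕ (k ⊖ (1 ℕD.mod N))    ≡⟨ cong (N ℕ.∸ 1 ℕ.∸_) (toℕ-⊖-mod 1 k 1<N 1≤k) ⟩
      N ℕ.∸ 1 ℕ.∸ (toℕ k ℕ.∸ 1)             ≡⟨ ∸-suc (N ℕ.∸ 1) (toℕ k ℕ.∸ 1) (subst (_≤ N ℕ.∸ 1) (sym suc[k∸1]) k≤N∸1) ⟩
      suc (N ℕ.∸ 1 ℕ.∸ suc (toℕ k ℕ.∸ 1))   ≡⟨ cong (λ j → suc (N ℕ.∸ 1 ℕ.∸ j)) suc[k∸1] ⟩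
      suc (N ℕ.∸ 1 ℕ.∸ toℕ k)               ∎
    previous : v (k ⊖ (1 ℕD.mod N)) ≡ u k + d * v k
    previous = trans (cong (from-top u) index)
                     (cong (_+ d * v k) (trans (cong (extend u) (ℕP.m∸[m∸n]≡n k≤N∸1)) (extend-toℕ u k)))

  σ-d-division : ∀ {M} → d ℤ.^ N ≋ 1ℤ [mod M ] → ∀ u k →
                 u k ≋ (σ-d-quotient u *ᴱ (σ -ᴱ ι d)) k + ι (φ d u) k [mod M ]
  σ-d-division {M} dᴺ≋1 u k = begin
    u k                                           ≡⟨ u≡w+R ⟩
    w k + R k                                     ≡⟨ cong (λ r → w k + r) (trans (R-support k) (ι-δ (R 0ᶠ) k)) ⟩
    w k + R 0ᶠ * ind (does (0ᶠ F.≟ k))            ≈⟨ ≋-+ (≋-refl {x = w k}) (≋-*ʳ (ind (does (0ᶠ F.≟ k))) R₀≋φu) ⟩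
    w k + φ d u * ind (does (0ᶠ F.≟ k))           ≡⟨ cong (λ r → w k + r) (ι-δ (φ d u) k) ⟨
    w k + ι (φ d u) k                             ∎
    where
    open SetoidReasoning ≋-setoid
    0ᶠ = 0 ℕD.mod N
    w : Elem N
    w = σ-d-quotient u *ᴱ (σ -ᴱ ι d)
    R : Elem N
    R a = u a - w a
    u≡w+R : u k ≡ w k + R k
    u≡w+R = lemma (u k) (w k)
      where lemma : ∀ u w → u ≡ w + (u - w)
            lemma = solve-∀
    R-support : ∀ a → R a ≡ ι (R 0ᶠ) a
    R-support a = trans (R≡ a) (sym (ι-δ (R 0ᶠ) a))
      where
      R≡ : ∀ a → R a ≡ R 0ᶠ * ind (does (0ᶠ F.≟ a))
      R≡ a with 0ᶠ F.≟ a
      ... | yes refl = sym (ℤP.*-identityʳ (R 0ᶠ))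
      ... | no  a≢0ᶠ = trans (trans (cong (λ z → u a - z) (σ-d-quotient-step u a a≢0)) (ℤP.+-inverseʳ (u a)))
                             (sym (ℤP.*-zeroʳ (R 0ᶠ)))
        where
        a≢0 : toℕ a ≢ 0
        a≢0 e = a≢0ᶠ (Equivalence.from (mod-≡⇔ 0 a) (trans (ℕD.m<n⇒m%n≡m (ℕ.>-nonZero⁻¹ N)) (sym e)))
    R₀≋φu : R 0ᶠ ≋ φ d u [mod M ]
    R₀≋φu = begin
      R 0ᶠ              ≡⟨ φ-ι (R 0ᶠ) ⟨
      φ d (ι {N} (R 0ᶠ)) ≡⟨ φ-cong {x = R} R-support ⟨
      φ d R             ≡⟨ trans (φ-+ u (-ᴱ w)) (cong (λ z → φ d u + z) (φ-neg w)) ⟩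
      φ d u - φ d w     ≈⟨ ≋-- (≋-refl {x = φ d u}) (φ-*ᴱ dᴺ≋1 (σ-d-quotient u) (σ -ᴱ ι d)) ⟩
      φ d u - φ d (σ-d-quotient u) * φ d (σ {N} -ᴱ ι d)
        ≡⟨ cong (λ z → φ d u - φ d (σ-d-quotient u) * z) (φ-σ-ι 1<N) ⟩
      φ d u - φ d (σ-d-quotient u) * 0ℤ
        ≡⟨ trans (cong (λ z → φ d u - z) (ℤP.*-zeroʳ (φ d (σ-d-quotient u)))) (ℤP.+-identityʳ (φ d u)) ⟩
      φ d u             ∎

  σ-d-division-scaled : ∀ {M} → d ℤ.^ N ≋ 1ℤ [mod M ] → ∀ u z → φ d u * z ≋ 0ℤ [mod M ] →
                        ∀ k → u k * z ≋ (σ-d-quotient u *ᴱ (ι z *ᴱ (σ -ᴱ ι d))) k [mod M ]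
  σ-d-division-scaled {M} dᴺ≋1 u z φu*z≋0 k = begin
    u k * z                                                 ≈⟨ ≋-*ʳ z (σ-d-division dᴺ≋1 u k) ⟩
    (w k + φ d u * ind (idxEq 0 k)) * z                     ≡⟨ lemma (w k) (φ d u) (ind (idxEq 0 k)) z ⟩
    z * w k + φ d u * z * ind (idxEq 0 k)                   ≈⟨ ≋-+ (≋-refl {x = z * w k}) (≋-*ʳ (ind (idxEq 0 k)) φu*z≋0) ⟩
    z * w k + 0ℤ                                            ≡⟨ ℤP.+-identityʳ (z * w k) ⟩
    z * w k                                                 ≡⟨ *ᴱ-ι-*ᴱ (σ-d-quotient u) (σ -ᴱ ι d) z k ⟨
    (σ-d-quotient u *ᴱ (ι z *ᴱ (σ -ᴱ ι d))) k               ∎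
    where
    open SetoidReasoning ≋-setoid
    w = σ-d-quotient u *ᴱ (σ -ᴱ ι d)
    lemma : ∀ w φ i z → (w + φ * i) * z ≡ z * w + φ * z * i
    lemma = solve-∀

-∞≢fin : ∀ {y} → -∞ ≢ fin y
-∞≢fin ()

fin-injective : ∀ {y y′} → fin y ≡ fin y′ → y ≡ y′
fin-injective refl = refl

<∞fin⇒≤ : ∀ {cv y} → cv <∞ fin y → ∀ y′ → cv ≡ fin y′ → y′ ≤ y
<∞fin⇒≤ (fin<fin y′<y) _ refl = ℕP.<⇒≤ y′<y

last-finite : ∀ t (c : Fin (suc t) → ℕ∞) → (∀ j k → j F.< k → c j <∞ c k) → (c F.zero ≡ -∞ → 0 < t) →
              Σ ℕ λ y → c (fromℕ t) ≡ fin y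
last-finite zero c _ c₀≡-∞⇒0<t with c F.zero
... | -∞    = ⊥-elim (ℕP.<-irrefl refl (c₀≡-∞⇒0<t refl))
... | fin y = y , refl
last-finite (suc t) c c-increasing _ with c (fromℕ (suc t)) | c-increasing F.zero (fromℕ (suc t)) (ℕ.s≤s ℕ.z≤n)
... | fin y | _ = y , refl

module LevelDecomposition
  (p : ℕ) .{{_ : NonZero p}} (1<p : 1 < p) (m i t : ℕ) (d : ℤ)
  (b : Fin (suc t) → ℕ) (c : Fin (suc t) → ℕ∞)
  (b+2≤m : ∀ j → b j ℕ.+ 2 ≤ m)
  (c<i : ∀ j y → c j ≡ fin y → y < i)
  (c-increasing : ∀ j k → j F.< k → c j <∞ c k)
  (c-last : Σ ℕ λ y → c (fromℕ t) ≡ fin y)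
  (b-last : b (fromℕ t) ≡ 0)
  (dᴺ≋1 : d ℤ.^ (p ℕ.^ i) ≋ 1ℤ [mod p ℕ.^ m ])
  (φP : ∀ (j : Fin t) → c (F.suc j) ≢ -∞ →
        Σ ℤ λ y → φ d (P {p ℕ.^ i} p i (c (F.suc j))) ≡ᶻ + (p ℕ.^ (1 ℕ.+ b (inject₁ j))) * y [mod p ℕ.^ m ])
  where

  Nᵢ q M : ℕ
  Nᵢ = p ℕ.^ i
  q  = p ℕ.^ (m ℕ.∸ 1)
  M  = p ℕ.^ m

  instance
    Nᵢ-nonZero : NonZero Nᵢ
    Nᵢ-nonZero = ℕP.m^n≢0 p i

  1<Nᵢ : 1 < Nᵢ
  1<Nᵢ = ℕP.<-≤-trans 1<p (subst (_≤ Nᵢ) (ℕP.^-identityʳ p) (ℕP.^-monoʳ-≤ p 0<i))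
    where 0<i = ℕP.<-≤-trans (ℕ.s≤s ℕ.z≤n) (c<i (fromℕ t) (proj₁ c-last) (proj₂ c-last))

  open Cyclic Nᵢ
  open Periodic Nᵢ
  open Evaluation Nᵢ d
  open Division Nᵢ 1<Nᵢ d

  e : Fin (suc t) → ℕ
  e l = m ℕ.∸ 1 ℕ.∸ b l

  b≤m∸1 : ∀ l → b l ≤ m ℕ.∸ 1
  b≤m∸1 l = ℕP.m+n≤o⇒m≤o∸n (b l) (ℕP.≤-trans (ℕP.+-monoʳ-≤ (b l) (ℕ.s≤s ℕ.z≤n)) (b+2≤m l))

  ≋q⇒≋p^[b+e] : ∀ l {x y} → x ≋ y [mod q ] → x ≋ y [mod p ℕ.^ (b l ℕ.+ e l) ]
  ≋q⇒≋p^[b+e] l {x} {y} = subst (λ r → x ≋ y [mod p ℕ.^ r ]) (sym (ℕP.m+[n∸m]≡n (b≤m∸1 l)))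

  c-suc-finite : ∀ (j : Fin t) → Σ ℕ λ y → c (F.suc j) ≡ fin y
  c-suc-finite j with c (F.suc j) | c-increasing F.zero (F.suc j) (ℕ.s≤s ℕ.z≤n)
  ... | fin y | _ = y , refl

  fold^ : ℕ → Fin Nᵢ → Fin Nᵢ
  fold^ y = fold (p ℕ.^ y) {{ℕP.m^n≢0 p y}}

  periodise : ℕ∞ → Elem Nᵢ → Elem Nᵢ
  periodise -∞      x k = 0ℤ
  periodise (fin y) x k = x (fold^ y k)

  periodise-fold : ∀ cv y → (∀ y′ → cv ≡ fin y′ → y′ ≤ y) → ∀ x k → periodise cv x (fold^ y k) ≡ periodise cv x k
  periodise-fold -∞       y _  x k = refl
  periodise-fold (fin y′) y ≤y x k =
    cong x (fold-fold (p ℕ.^ y′) (p ℕ.^ y) {{ℕP.m^n≢0 p y′}} {{ℕP.m^n≢0 p y}} (^-monoʳ-∣ p (≤y y′ refl)) k)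

  -- For c = -∞ the generator p^β (σ^(p^c) - 1) = -p^β is replaced by p^β.
  Kills : ℕ → ℕ∞ → Elem Nᵢ → Set
  Kills β -∞      x = ∀ k → (x *ᴱ ι (+ (p ℕ.^ β))) k ≋ 0ℤ [mod q ]
  Kills β (fin y) x = ∀ k → (x *ᴱ (ι (+ (p ℕ.^ β)) *ᴱ (σpow p (fin y) -ᴱ 1ᴱ))) k ≋ 0ℤ [mod q ]

  kills⇒≋periodise : ∀ l x → Kills (b l) (c l) x → ∀ k → x k ≋ periodise (c l) x k [mod p ℕ.^ e l ]
  kills⇒≋periodise l x kills with c l | c<i l
  ... | -∞    | _   = λ k → ≋-cancel-^ p (b l) (e l) (x k)
                              (≋q⇒≋p^[b+e] l (subst (λ z → z ≋ 0ℤ [mod q ])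
                                (trans (*ᴱ-ι x (+ (p ℕ.^ b l)) k) (ℤP.*-comm (x k) _)) (kills k)))
  ... | fin y | y<i = shift-invariant⇒periodic (p ℕ.^ y) {{ℕP.m^n≢0 p y}}
                        (ℕP.^-monoʳ-< p 1<p (y<i y refl)) x
                        (λ k → -≋0⇒≋ (≋-cancel-^ p (b l) (e l) (x (k ⊖ (p ℕ.^ y ℕD.mod Nᵢ)) - x k)
                                 (≋q⇒≋p^[b+e] l (subst (λ z → z ≋ 0ℤ [mod q ])
                                   (*ᴱ-[σ^-1] x (+ (p ℕ.^ b l)) (p ℕ.^ y) k) (kills k)))))

  truncate-*ᴱ-P : ∀ y → y < i → ∀ (W g : Elem Nᵢ) z → (∀ a → g a ≡ z * P p i (fin y) a) →
                  ∀ k → (truncate (p ℕ.^ y) W *ᴱ g) k ≡ z * W (fold^ y k)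
  truncate-*ᴱ-P y y<i W g z g≡zP k =
    truncate-*ᴱ (p ℕ.^ y) {{ℕP.m^n≢0 p y}} (^-monoʳ-∣ p (ℕP.<⇒≤ y<i)) W g z k
                (λ a → trans (g≡zP a) (cong (z *_) (P-indicator p i y (ℕP.<⇒≤ y<i) a)))

  qσ-d : Elem Nᵢ
  qσ-d = ι (+ q) *ᴱ (σ -ᴱ ι d)

  scaledP : Fin t → Elem Nᵢ
  scaledP j = ι (+ (p ℕ.^ e (inject₁ j))) *ᴱ P p i (c (F.suc j))

  e+[1+b]≡m : ∀ l → e l ℕ.+ (1 ℕ.+ b l) ≡ m
  e+[1+b]≡m l = begin
    e l ℕ.+ (1 ℕ.+ b l)   ≡⟨ cong (e l ℕ.+_) (ℕP.+-comm 1 (b l)) ⟩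
    e l ℕ.+ (b l ℕ.+ 1)   ≡⟨ ℕP.+-assoc (e l) (b l) 1 ⟨
    e l ℕ.+ b l ℕ.+ 1     ≡⟨ cong (ℕ._+ 1) (ℕP.m∸n+n≡m (b≤m∸1 l)) ⟩
    m ℕ.∸ 1 ℕ.+ 1         ≡⟨ ℕP.m∸n+n≡m (ℕP.<⇒≤ (ℕP.≤-trans (ℕP.m≤n+m 2 (b l)) (b+2≤m l))) ⟩
    m                     ∎
    where open ≡-Reasoning

  φ-*ᴱscaledP≋0 : ∀ j s → φ d (s *ᴱ scaledP j) ≋ 0ℤ [mod M ]
  φ-*ᴱscaledP≋0 j s = begin
    φ d (s *ᴱ scaledP j)                     ≈⟨ φ-*ᴱ dᴺ≋1 s (scaledP j) ⟩
    φ d s * φ d (scaledP j)                  ≈⟨ ≋-*ˡ (φ d s) (φ-*ᴱ dᴺ≋1 (ι z) Pⱼ) ⟩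
    φ d s * (φ d (ι {Nᵢ} z) * φ d Pⱼ)  ≈⟨ ≋-*ˡ (φ d s) (≋-* (≋-reflexive (φ-ι z)) (≡ᶻ⇒≋ (proj₂ Y))) ⟩
    φ d s * (z * (p^[1+b] * proj₁ Y))  ≡⟨ cong (φ d s *_) split ⟩
    φ d s * (proj₁ Y * + M)            ≈⟨ ≋-*ˡ (φ d s) (*q≋0 (proj₁ Y)) ⟩
    φ d s * 0ℤ                         ≡⟨ ℤP.*-zeroʳ (φ d s) ⟩
    0ℤ                                 ∎
    where
    open SetoidReasoning ≋-setoid
    z = + (p ℕ.^ e (inject₁ j))
    p^[1+b] = + (p ℕ.^ (1 ℕ.+ b (inject₁ j)))
    Pⱼ = P {Nᵢ} p i (c (F.suc j))
    Y = φP j (λ c≡-∞ → -∞≢fin (trans (sym c≡-∞) (proj₂ (c-suc-finite j))))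
    split : z * (p^[1+b] * proj₁ Y) ≡ proj₁ Y * + M
    split = trans (sym (ℤP.*-assoc z p^[1+b] (proj₁ Y)))
                  (trans (cong (_* proj₁ Y) (trans (sym (ℤP.pos-* (p ℕ.^ e (inject₁ j)) _))
                           (cong +_ (trans (sym (ℕP.^-distribˡ-+-* p (e (inject₁ j)) _)) (cong (p ℕ.^_) (e+[1+b]≡m (inject₁ j)))))))
                         (ℤP.*-comm (+ M) (proj₁ Y)))

  module _ (x : Elem Nᵢ) (level : ∀ l k → x k ≋ periodise (c l) x k [mod p ℕ.^ e l ]) where

    difference : Fin t → Elem Nᵢ
    difference j k = periodise (c (F.suc j)) x k - periodise (c (inject₁ j)) x k

    difference≋0 : ∀ j k → difference j k ≋ 0ℤ [mod p ℕ.^ e (inject₁ j) ]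
    difference≋0 j k with c (F.suc j) | c-increasing (inject₁ j) (F.suc j) (FP.≤̄⇒inject₁< ℕP.≤-refl)
    ... | fin y | c<y = ≋⇒-≋0 (≋-trans (level (inject₁ j) (fold^ y k))
                                       (≋-reflexive (periodise-fold (c (inject₁ j)) y (<∞fin⇒≤ c<y) x k)))

    difference-periodic : ∀ j y → c (F.suc j) ≡ fin y → ∀ k → difference j (fold^ y k) ≡ difference j k
    difference-periodic j y c≡y k =
      cong₂ _-_ (periodise-fold (c (F.suc j)) y (λ y′ c≡y′ → ℕP.≤-reflexive (fin-injective (trans (sym c≡y′) c≡y))) x k)
                (periodise-fold (c (inject₁ j)) y (<∞fin⇒≤ (subst (c (inject₁ j) <∞_) c≡y
                  (c-increasing (inject₁ j) (F.suc j) (FP.≤̄⇒inject₁< ℕP.≤-refl)))) x k)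

    difference∈⟨scaledP⟩ : ∀ j → Σ (Elem Nᵢ) λ s → ∀ k → (s *ᴱ scaledP j) k ≡ difference j k
    difference∈⟨scaledP⟩ j = truncate (p ℕ.^ y) W , λ k → begin
      (truncate (p ℕ.^ y) W *ᴱ scaledP j) k
        ≡⟨ truncate-*ᴱ-P y (c<i (F.suc j) y c≡y) W (scaledP j) z
             (λ a → trans (ι-*ᴱ z (P p i (c (F.suc j))) a) (cong (λ cv → z * P p i cv a) c≡y)) k ⟩
      z * W (fold^ y k)          ≡⟨ ℤP.*-comm z (W (fold^ y k)) ⟩
      W (fold^ y k) * z          ≡⟨ proj₂ (≋0⇒multiple (difference≋0 j (fold^ y k))) ⟨
      difference j (fold^ y k)   ≡⟨ difference-periodic j y c≡y k ⟩
      difference j k             ∎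
      where
      open ≡-Reasoning
      y = proj₁ (c-suc-finite j)
      c≡y = proj₂ (c-suc-finite j)
      z = + (p ℕ.^ e (inject₁ j))
      W : Elem Nᵢ
      W a = proj₁ (≋0⇒multiple (difference≋0 j a))

    difference-coefficient : Fin t → Elem Nᵢ
    difference-coefficient j = proj₁ (difference∈⟨scaledP⟩ j)

    X₀ S : Elem Nᵢ
    X₀ = periodise (c F.zero) x
    S k = sumF (λ j → difference j k)

    x-Xₜ≋0 : ∀ k → x k - periodise (c (fromℕ t)) x k ≋ 0ℤ [mod q ]
    x-Xₜ≋0 k = ≋⇒-≋0 (subst (λ β → x k ≋ periodise (c (fromℕ t)) x k [mod p ℕ.^ (m ℕ.∸ 1 ℕ.∸ β) ])
                            b-last (level (fromℕ t) k))

    remainder : Elem Nᵢ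
    remainder k = proj₁ (≋0⇒multiple (x-Xₜ≋0 k))

    telescoped : ∀ k → x k ≡ X₀ k + S k + remainder k * + q
    telescoped k = trans (lemma (proj₂ (≋0⇒multiple (x-Xₜ≋0 k))))
                         (cong (_+ remainder k * + q) (sumF-telescope t (λ l → periodise (c l) x k)))
      where
      lemma : ∀ {a b w} → a - b ≡ w → a ≡ b + w
      lemma {a} {b} refl = sym (solve a b)
        where solve : ∀ a b → b + (a - b) ≡ a
              solve = solve-∀

    φ-telescoped : φ d x ≡ φ d X₀ + sumF (λ j → φ d (difference j)) + φ d remainder * + q
    φ-telescoped = begin
      φ d x                                         ≡⟨ φ-cong telescoped ⟩
      φ d ((X₀ +ᴱ S) +ᴱ (λ k → remainder k * + q))  ≡⟨ φ-+ (X₀ +ᴱ S) (λ k → remainder k * + q) ⟩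
      φ d (X₀ +ᴱ S) + φ d (λ k → remainder k * + q) ≡⟨ cong₂ _+_ (φ-+ X₀ S) (φ-*ʳ remainder (+ q)) ⟩
      φ d X₀ + φ d S + φ d remainder * + q          ≡⟨ cong (λ r → φ d X₀ + r + φ d remainder * + q)
                                                           (φ-sumF difference) ⟩
      φ d X₀ + sumF (λ j → φ d (difference j)) + φ d remainder * + q ∎
      where open ≡-Reasoning

    φ-remainder*q≋0 : φ d x ≋ 0ℤ [mod M ] → φ d X₀ ≋ 0ℤ [mod M ] → φ d remainder * + q ≋ 0ℤ [mod M ]
    φ-remainder*q≋0 φx≋0 φX₀≋0 = begin
      φ d remainder * + q                               ≡⟨ lemma {b = φ d X₀} φ-telescoped ⟩
      φ d x - (φ d X₀ + sumF (λ j → φ d (difference j))) ≈⟨ ≋-- φx≋0 (≋-+ φX₀≋0 (≋-sumF {g = λ _ → 0ℤ} φ-difference≋0)) ⟩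
      0ℤ - (0ℤ + sumF {t} (λ _ → 0ℤ))                   ≡⟨ cong (λ r → 0ℤ - (0ℤ + r)) (sumF-0 t) ⟩
      0ℤ                                                ∎
      where
      open SetoidReasoning ≋-setoid
      lemma : ∀ {a b s w} → a ≡ b + s + w → w ≡ a - (b + s)
      lemma {b = b} {s} {w} refl = solve b s w
        where solve : ∀ b s w → w ≡ b + s + w - (b + s)
              solve = solve-∀
      φ-difference≋0 : ∀ j → φ d (difference j) ≋ 0ℤ [mod M ]
      φ-difference≋0 j = ≋-trans (≋-reflexive (φ-cong (λ k → sym (proj₂ (difference∈⟨scaledP⟩ j) k))))
                                 (φ-*ᴱscaledP≋0 j (difference-coefficient j))

    decomposition : φ d x ≋ 0ℤ [mod M ] → φ d X₀ ≋ 0ℤ [mod M ] →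
                    Σ (Elem Nᵢ) λ v → ∀ k →
                    x k ≋ X₀ k + sumF (λ l → ((v ∷ difference-coefficient) l *ᴱ (qσ-d ∷ scaledP) l) k) [mod M ]
    decomposition φx≋0 φX₀≋0 = σ-d-quotient remainder , λ k → begin
      x k                                         ≡⟨ telescoped k ⟩
      X₀ k + S k + remainder k * + q              ≈⟨ ≋-+ (≋-refl {x = X₀ k + S k})
                                                       (σ-d-division-scaled dᴺ≋1 remainder (+ q)
                                                          (φ-remainder*q≋0 φx≋0 φX₀≋0) k) ⟩
      X₀ k + S k + (v *ᴱ qσ-d) k                  ≡⟨ lemma (X₀ k) (S k) _ ⟩
      X₀ k + ((v *ᴱ qσ-d) k + S k)                ≡⟨ cong (λ r → X₀ k + ((v *ᴱ qσ-d) k + r))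
                                                       (sumF-cong (λ j → proj₂ (difference∈⟨scaledP⟩ j) k)) ⟨
      X₀ k + ((v *ᴱ qσ-d) k + sumF (λ j → (difference-coefficient j *ᴱ scaledP j) k)) ∎
      where
      open SetoidReasoning ≋-setoid
      v = σ-d-quotient remainder
      lemma : ∀ a s w → a + s + w ≡ a + (w + s)
      lemma = solve-∀

  finite-kills : ∀ {β cv x} → Σ ℕ (λ y → cv ≡ fin y) →
                 (∀ k → (x *ᴱ (ι (+ (p ℕ.^ β)) *ᴱ (σpow p cv -ᴱ 1ᴱ))) k ≋ 0ℤ [mod q ]) → Kills β cv x
  finite-kills (y , refl) kills = kills

  -- The generators of the ideal in AnnHyp c₀ (local to its definition there).
  annihilated : ℕ∞ → Fin (suc t) → Elem Nᵢ
  annihilated -∞      F.zero    = ι (+ (p ℕ.^ b F.zero))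
  annihilated -∞      (F.suc j) = ι (+ (p ℕ.^ b (F.suc j))) *ᴱ (σpow p (c (F.suc j)) -ᴱ 1ᴱ)
  annihilated (fin _) j         = ι (+ (p ℕ.^ b j)) *ᴱ (σpow p (c j) -ᴱ 1ᴱ)

  annHyp⇒kills : ∀ x c₀ → c F.zero ≡ c₀ → AnnHyp p m i d b c c₀ x → ∀ l → Kills (b l) (c l) x
  annHyp⇒kills x -∞ c₀≡ ann F.zero =
    subst (λ cv → Kills (b F.zero) cv x) (sym c₀≡) (annihilator-kills-generator q (annihilated -∞) x ann F.zero)
  annHyp⇒kills x (fin y₀) c₀≡ ann F.zero =
    finite-kills (y₀ , c₀≡) (annihilator-kills-generator q (annihilated (fin y₀)) x ann F.zero)
  annHyp⇒kills x -∞ c₀≡ ann (F.suc j) =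
    finite-kills (c-suc-finite j) (annihilator-kills-generator q (annihilated -∞) x ann (F.suc j))
  annHyp⇒kills x (fin y₀) c₀≡ ann (F.suc j) =
    finite-kills (c-suc-finite j) (annihilator-kills-generator q (annihilated (fin y₀)) x ann (F.suc j))

  annHyp⇒concl : ∀ x → φ d x ≋ 0ℤ [mod M ] →
               (c F.zero ≢ -∞ → φ d (P {Nᵢ} p i (c F.zero)) ≡ᶻ 0ℤ [mod M ]) →
               ∀ c₀ → c F.zero ≡ c₀ → AnnHyp p m i d b c c₀ x → Concl p m i d b c c₀ x
  annHyp⇒concl x φx≋0 φP₀ -∞ c₀≡ ann =
    combination⇒InIdeal coefficients (qσ-d ∷ scaledP) x λ k →
      ≋-trans (proj₂ decomposed k)
              (≋-reflexive (trans (cong (λ cv → periodise cv x k + combination k) c₀≡) (ℤP.+-identityˡ _)))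
    where
    level = λ l → kills⇒≋periodise l x (annHyp⇒kills x -∞ c₀≡ ann l)
    decomposed = decomposition x level φx≋0 (≋-reflexive (trans (cong (λ cv → φ d (periodise cv x)) c₀≡) φ-0))
    coefficients = proj₁ decomposed ∷ difference-coefficient x level
    combination = λ k → sumF (λ l → (coefficients l *ᴱ (qσ-d ∷ scaledP) l) k)
  annHyp⇒concl x φx≋0 φP₀ (fin y₀) c₀≡ ann =
    combination⇒InIdeal (truncate (p ℕ.^ y₀) x ∷ proj₁ decomposed ∷ difference-coefficient x level)
                        (P p i (c F.zero) ∷ qσ-d ∷ scaledP) x λ k →
      ≋-trans (proj₂ decomposed k) (≋-reflexive (cong (_+ combination k) (sym (periodised k))))
    where
    level = λ l → kills⇒≋periodise l x (annHyp⇒kills x (fin y₀) c₀≡ ann l)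
    periodised : ∀ k → (truncate (p ℕ.^ y₀) x *ᴱ P p i (c F.zero)) k ≡ periodise (c F.zero) x k
    periodised k =
      trans (truncate-*ᴱ-P y₀ (c<i F.zero y₀ c₀≡) x (P p i (c F.zero)) 1ℤ
               (λ a → trans (cong (λ cv → P p i cv a) c₀≡) (sym (ℤP.*-identityˡ _))) k)
            (trans (ℤP.*-identityˡ _) (cong (λ cv → periodise cv x k) (sym c₀≡)))
    φX₀≋0 : φ d (periodise (c F.zero) x) ≋ 0ℤ [mod M ]
    φX₀≋0 = begin
      φ d (periodise (c F.zero) x)                   ≡⟨ φ-cong periodised ⟨
      φ d (truncate (p ℕ.^ y₀) x *ᴱ P p i (c F.zero)) ≈⟨ φ-*ᴱ dᴺ≋1 (truncate (p ℕ.^ y₀) x) (P p i (c F.zero)) ⟩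
      φ d (truncate (p ℕ.^ y₀) x) * φ d (P {Nᵢ} p i (c F.zero))
        ≈⟨ ≋-*ˡ (φ d (truncate (p ℕ.^ y₀) x)) (≡ᶻ⇒≋ (φP₀ (λ c≡-∞ → -∞≢fin (trans (sym c≡-∞) c₀≡)))) ⟩
      φ d (truncate (p ℕ.^ y₀) x) * 0ℤ               ≡⟨ ℤP.*-zeroʳ (φ d (truncate (p ℕ.^ y₀) x)) ⟩
      0ℤ                                             ∎
      where open SetoidReasoning ≋-setoid
    decomposed = decomposition x level φx≋0 φX₀≋0
    combination = λ k → sumF (λ l → ((proj₁ decomposed ∷ difference-coefficient x level) l *ᴱ (qσ-d ∷ scaledP) l) k)

  φ-[σ-d]*≋0 : ∀ r → φ d ((σ -ᴱ ι d) *ᴱ r) ≋ 0ℤ [mod M ]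
  φ-[σ-d]*≋0 r = ≋-trans (φ-*ᴱ dᴺ≋1 (σ -ᴱ ι d) r)
                         (≋-reflexive (trans (cong (_* φ d r) (φ-σ-ι 1<Nᵢ)) (ℤP.*-zeroˡ (φ d r))))

lemma2p9 : (p : ℕ) → Prime p → (n m i t : ℕ) → 2 ≤ m → i ≤ n → (d : ℤ)
    → (b : Fin (suc t) → ℕ) → (c : Fin (suc t) → ℕ∞)
    → (∀ j → b j ℕ.+ 2 ≤ m)
    → (∀ j k → j F.< k → b k < b j)
    → (∀ j x → c j ≡ fin x → x < i)
    → (∀ j k → j F.< k → c j <∞ c k)
    → (c F.zero ≡ -∞ → 0 < t)
    → (d ℤ.^ (p ℕ.^ i)) ≡ᶻ 1ℤ [mod p ℕ.^ m ]
    → b (fromℕ t) ≡ 0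
    → (∀ (j : Fin t) → c (F.suc j) ≢ -∞
         → Σ ℤ λ y → φ d (P {p ℕ.^ i} p i (c (F.suc j))) ≡ᶻ (+ (p ℕ.^ (1 ℕ.+ b (inject₁ j)))) * y [mod p ℕ.^ m ])
    → (c F.zero ≢ -∞ → φ d (P {p ℕ.^ i} p i (c F.zero)) ≡ᶻ 0ℤ [mod p ℕ.^ m ])
    → (r : Elem (p ℕ.^ i))
    → AnnHyp p m i d b c (c F.zero) ((σ -ᴱ ι d) *ᴱ r)
    → Concl p m i d b c (c F.zero) ((σ -ᴱ ι d) *ᴱ r)
-- Unused: n and i ≤ n, the monotonicity of b, and 2 ≤ m (implied by b j + 2 ≤ m).
lemma2p9 p p-prime _ m i t _ _ d b c b+2≤m _ c<i c-increasing c₀≡-∞⇒0<t dᴺ≡1 b-last φP φP₀ r ann =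
  annHyp⇒concl ((σ -ᴱ ι d) *ᴱ r) (φ-[σ-d]*≋0 r) φP₀ (c F.zero) refl ann
  where
  instance _ = prime⇒nonZero p-prime
  open LevelDecomposition p (ℕ.nonTrivial⇒n>1 p {{prime⇒nonTrivial p-prime}}) m i t d b c b+2≤m c<i c-increasing
                (last-finite t c c-increasing c₀≡-∞⇒0<t) b-last (≡ᶻ⇒≋ dᴺ≡1) φP
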